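{- Let $\mathbb{G}=(V,E)$ be a coloured ribbon graph with vertex colouring $\mathcal{V}$ and boundary colouring $\mathcal{B}$, and $e\in E$. After removing isolated vertices: $\mathbb{G}/e^c=\mathrm{bs}$ iff $e$ is a loop in $\mathbb{G}^*/\mathcal{B}$, an orientable doop in $\mathbb{G}$, and a bridge in $\mathbb{G}/\mathcal{V}$; $\mathbb{G}/e^c=\mathrm{bp}$ iff $e$ is a loop in $\mathbb{G}^*/\mathcal{B}$, an orientable doop in $\mathbb{G}$, and not a bridge in $\mathbb{G}/\mathcal{V}$; $\mathbb{G}/e^c=\mathrm{olc}$ iff $e$ is not a loop in $\mathbb{G}^*/\mathcal{B}$, not a doop in $\mathbb{G}$, and not a bridge in $\mathbb{G}/\mathcal{V}$; $\mathbb{G}/e^c=\mathrm{olh}$ iff $e$ is a loop in $\mathbb{G}^*/\mathcal{B}$, not a doop in $\mathbb{G}$, and not a bridge in $\mathbb{G}/\mathcal{V}$; $\mathbb{G}/e^c=\mathrm{nl}$ iff $e$ is a loop in $\mathbb{G}^*/\mathcal{B}$, a non-orientable doop in $\mathbb{G}$, and not a bridge in $\mathbb{G}/\mathcal{V}$; $\mathbb{G}\backslash e^c=\mathrm{bs}$ iff $e$ is not a bridge in $\mathbb{G}^*/\mathcal{B}$, not a loop in $\mathbb{G}$, and not a loop in $\mathbb{G}/\mathcal{V}$; $\mathbb{G}\backslash e^c=\mathrm{bp}$ iff $e$ is not a bridge in $\mathbb{G}^*/\mathcal{B}$, not a loop in $\mathbb{G}$, and a loop in $\mathbb{G}/\mathcal{V}$;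 $\mathbb{G}\backslash e^c=\mathrm{olc}$ iff $e$ is a bridge in $\mathbb{G}^*/\mathcal{B}$, an orientable loop in $\mathbb{G}$, and a loop in $\mathbb{G}/\mathcal{V}$; $\mathbb{G}\backslash e^c=\mathrm{olh}$ iff $e$ is not a bridge in $\mathbb{G}^*/\mathcal{B}$, an orientable loop in $\mathbb{G}$, and a loop in $\mathbb{G}/\mathcal{V}$; $\mathbb{G}\backslash e^c=\mathrm{nl}$ iff $e$ is not a bridge in $\mathbb{G}^*/\mathcal{B}$, a non-orientable loop in $\mathbb{G}$, and a loop in $\mathbb{G}/\mathcal{V}$.
   Context: A ribbon graph $\mathbb{G}=(V,E)$ is a surface with boundary represented as a union of two finite sets of closed discs, vertices and edges, meeting in disjoint line segments, each on the boundary of exactly one vertex and one edge, each edge containing exactly two such segments; $F(\mathbb{G})$ is its set of boundary components. A loop is an edge meeting one vertex; non-orientable if its union with its vertex is a Möbius band, orientable otherwise. Deletion $\mathbb{G}\backslash e$ removes $e$; contraction $\mathbb{G}/e$ glues a disc (new vertex) along each boundary component of $e\cup u\cup v$ ($u,v$ the ends of $e$) and removes $e,u,v$ (non-loop: ends merge; non-orientable loop: one new vertex; orientable loop: two new vertices; boundary components unchanged). Sets of edges are deleted/contracted one at a time; $e^c=E\setminus\{e\}$. The dual $\mathbb{G}^*$ caps each boundary component with a disc (its vertices), with the same edges; $e$ is a doop if it is a loop in $\mathbb{G}^*$, orientable/non-orientable as that loop is. A coloured ribbon graph has a partition $\mathcal{V}$ of $V$ into vertex colour classes and a partition $\mathcal{B}$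 of $F(\mathbb{G})$ into boundary colour classes. Contraction of $e$: boundary classes unchanged; if distinct ends $u,v$ merge into $p$, the classes of $u,v$ merge into one class containing $p$; if $e$ is a non-orientable loop at $u$ producing $p$, $p$ replaces $u$; if an orientable loop at $u$ producing $p,q$, both replace $u$ in its class. Deletion of $e$: vertex classes unchanged; if $e$ meets distinct boundary components $a,b$ merging into $r$, their classes merge into one class containing $r$; if $e$ meets one boundary component $a$, the resulting one or two components replace $a$ in its class. Other elements keep their classes. $\mathbb{G}/\mathcal{V}$ is the (abstract) graph on the vertex colour classes with an edge for each edge of $\mathbb{G}$ joining the classes of its ends; $\mathbb{G}^*/\mathcal{B}$ is the graph on the boundary colour classes with an edge for each edge $e$ joining the classes of the boundary components touching $e$ (loops and bridges in the usual graph sense). The one-edge coloured ribbon graphs: $\mathrm{bs}$ = an edge joining two distinct vertices in different vertex colour classes; $\mathrm{bp}$ = an edge joining two distinct vertices in the same vertex colour class; $\mathrm{olc}$ = one vertex with an orientable loop whose two boundary components are in different boundary colour classes; $\mathrm{olh}$ = same with the two boundary components in the same class; $\mathrm{nl}$ = one vertex with a non-orientable loop. -}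

module Defs where

open import Data.Nat using (ℕ; zero; suc; _*_; _+_)
open import Data.Bool using (Bool; true; false; not; if_then_else_)
open import Data.Fin using (Fin; _≟_)
open import Data.List using (List; filter; foldl)
open import Data.List.Base using (allFin)
open import Data.Product using (Σ; _×_; _,_; proj₁)
open import Data.Sum using (_⊎_)
open import Relation.Nullary using (¬_; does)
open import Relation.Nullary.Decidable using (¬?)
open import Relation.Binary.PropositionalEquality using (_≡_; _≢_)
open import Relation.Binary.Construct.Closure.ReflexiveTransitive using (Star)
open import Relation.Binary.Construct.Closure.Equivalence using (EqClosure)

-- Combinatorial model of ribbon graphs: graph-encoded maps (gems).  Each edge e carries four flags (e , i , s):
-- i = which end of e, s = which side of e.
-- θ₀ : other end, same side   (runs along a side of the edge)
-- θ₂ : same end, other side   (runs across the end of the edge)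
-- θ  : (= θ₁) a fixed-point-free involution pairing flags that are
--      consecutive around a vertex (a "corner" of a vertex disc).
-- Vertices  = orbits of ⟨θ , θ₂⟩,  boundary components = orbits of ⟨θ₀ , θ⟩.
-- Isolated vertices carry no flags.

Flag : ℕ → Set
Flag n = Fin n × Bool × Bool

fl : ∀ {n} → Fin n → Bool → Bool → Flag n
fl e i s = e , i , s

edgeOf : ∀ {n} → Flag n → Fin n
edgeOf = proj₁

θ₀ : ∀ {n} → Flag n → Flag n
θ₀ (e , i , s) = e , not i , s

θ₂ : ∀ {n} → Flag n → Flag n
θ₂ (e , i , s) = e , i , not s

-- swapping the roles of θ₀ and θ₂ (duality) on one flag
σ : ∀ {n} → Flag n → Flag n
σ (e , i , s) = e , s , i

-- σ applied only to flags of the edge e (partial duality at e)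
σAt : ∀ {n} → Fin n → Flag n → Flag n
σAt e x = if does (e ≟ edgeOf x) then σ x else x

VStep : ∀ {n} → (Flag n → Flag n) → Flag n → Flag n → Set
VStep θ x y = (y ≡ θ x) ⊎ (y ≡ θ₂ x)

FStep : ∀ {n} → (Flag n → Flag n) → Flag n → Flag n → Set
FStep θ x y = (y ≡ θ x) ⊎ (y ≡ θ₀ x)

SameVertex : ∀ {n} → (Flag n → Flag n) → Flag n → Flag n → Set
SameVertex θ = Star (VStep θ)

SameFace : ∀ {n} → (Flag n → Flag n) → Flag n → Flag n → Set
SameFace θ = Star (FStep θ)

dualθ : ∀ {n} → (Flag n → Flag n) → Flag n → Flag n
dualθ θ x = σ (θ (σ x))

-- Removing edges: the corner structure θ of the ribbon graph in which
-- only the edges with alive = true remain (corners merge across the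
-- removed edge ends).  The fuel 4n+4 exceeds the number of removed
-- edge ends, so the iteration always finishes.

skip : ∀ {n} → (Fin n → Bool) → (Flag n → Flag n) → ℕ → Flag n → Flag n
skip alive θ zero    y = y
skip alive θ (suc k) y =
  if alive (edgeOf y) then y else skip alive θ k (θ (θ₂ y))

restrictθ : ∀ {n} → (Fin n → Bool) → (Flag n → Flag n) → Flag n → Flag n
restrictθ {n} alive θ x = skip alive θ (4 * n + 4) (θ x)

onlyEdge : ∀ {n} → Fin n → Fin n → Bool
onlyEdge e f = does (e ≟ f)

IsLoop : ∀ {n} → (Flag n → Flag n) → Fin n → Set
IsLoop θ e = SameVertex θ (fl e false false) (fl e true false)

-- A one-edge ribbon graph (corner map θ₁ on the flags of e) is
-- orientable iff its gem is bipartite (standard criterion).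
Orientable₁ : ∀ {n} → (Flag n → Flag n) → Fin n → Set
Orientable₁ θ₁ e =
  Σ (Flag _ → Bool) λ c → ∀ i s → let x = fl e i s in
    (c (θ₀ x) ≢ c x) × (c (θ₂ x) ≢ c x) × (c (θ₁ x) ≢ c x)

subθ : ∀ {n} → (Flag n → Flag n) → Fin n → Flag n → Flag n
subθ θ e = restrictθ (onlyEdge e) θ

OrientableLoop : ∀ {n} → (Flag n → Flag n) → Fin n → Set
OrientableLoop θ e = IsLoop θ e × Orientable₁ (subθ θ e) e

NonOrientableLoop : ∀ {n} → (Flag n → Flag n) → Fin n → Set
NonOrientableLoop θ e = IsLoop θ e × ¬ Orientable₁ (subθ θ e) e

IsDoop : ∀ {n} → (Flag n → Flag n) → Fin n → Set
IsDoop θ e = IsLoop (dualθ θ) e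

OrientableDoop : ∀ {n} → (Flag n → Flag n) → Fin n → Set
OrientableDoop θ e = OrientableLoop (dualθ θ) e

NonOrientableDoop : ∀ {n} → (Flag n → Flag n) → Fin n → Set
NonOrientableDoop θ e = NonOrientableLoop (dualθ θ) e

-- The vertex colouring 𝒱 is a labelling of vertices (constant on vertex
-- orbits), the boundary colouring ℬ a labelling of boundary components
-- (constant on boundary orbits); classes = fibres of the labelling.

record ColouredRibbonGraph (n : ℕ) : Set where
  field
    θ      : Flag n → Flag n
    θ-inv  : ∀ x → θ (θ x) ≡ x
    θ-fpf  : ∀ x → θ x ≢ x
    colV   : Flag n → ℕ
    colB   : Flag n → ℕ
    colV-vertex : ∀ x y → SameVertex θ x y → colV x ≡ colV y
    colB-face   : ∀ x y → SameFace θ x y → colB x ≡ colB y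

-- Working form used for deletion/contraction: alive edges, corner map,
-- and the colour classes as equivalence relations on flags (a flag
-- stands for the vertex / boundary component containing it).

record CState (n : ℕ) : Set₁ where
  field
    alive : Fin n → Bool
    θ     : Flag n → Flag n
    VRel  : Flag n → Flag n → Set
    BRel  : Flag n → Flag n → Set

SameEdge : ∀ {n} → Fin n → Flag n → Flag n → Set
SameEdge e x y = (edgeOf x ≡ e) × (edgeOf y ≡ e)

_∪R_ : ∀ {n} → (Flag n → Flag n → Set) → (Flag n → Flag n → Set) →
       Flag n → Flag n → Set
(R ∪R S) x y = R x y ⊎ S x y

kill : ∀ {n} → Fin n → (Fin n → Bool) → Fin n → Bool
kill e alive f = if does (e ≟ f) then false else alive f

toState : ∀ {n} → ColouredRibbonGraph n → CState n
toState G = record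
  { alive = λ _ → true
  ; θ     = ColouredRibbonGraph.θ G
  ; VRel  = λ x y → ColouredRibbonGraph.colV G x ≡ ColouredRibbonGraph.colV G y
  ; BRel  = λ x y → ColouredRibbonGraph.colB G x ≡ ColouredRibbonGraph.colB G y
  }

-- deletion of e: vertex classes unchanged; boundary classes of the
-- boundary components met by e are merged (if e meets one component,
-- the new components stay in its class).
deleteEdge : ∀ {n} → Fin n → CState n → CState n
deleteEdge e S = record
  { alive = kill e (CState.alive S)
  ; θ     = restrictθ (kill e (CState.alive S)) (CState.θ S)
  ; VRel  = CState.VRel S
  ; BRel  = EqClosure (CState.BRel S ∪R SameEdge e)
  }

-- contraction of e = partial dual at e followed by deletion of e;
-- boundary classes unchanged; the vertex classes of the ends of e are
-- merged (for a loop this changes nothing: new vertices replace the old).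
contractEdge : ∀ {n} → Fin n → CState n → CState n
contractEdge e S = record
  { alive = kill e (CState.alive S)
  ; θ     = restrictθ (kill e (CState.alive S))
              (λ x → σAt e (CState.θ S (σAt e x)))
  ; VRel  = EqClosure (CState.VRel S ∪R SameEdge e)
  ; BRel  = CState.BRel S
  }

others : ∀ {n} → Fin n → List (Fin n)
others e = filter (λ f → ¬? (e ≟ f)) (allFin _)

contractAllBut : ∀ {n} → ColouredRibbonGraph n → Fin n → CState n
contractAllBut G e = foldl (λ S f → contractEdge f S) (toState G) (others e)

deleteAllBut : ∀ {n} → ColouredRibbonGraph n → Fin n → CState n
deleteAllBut G e = foldl (λ S f → deleteEdge f S) (toState G) (others e)

-- The one-edge coloured ribbon graphs (H has e as its only edge;
-- isolated vertices carry no flags, so they are automatically removed).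

module _ {n : ℕ} (H : CState n) (e : Fin n) where
  private
    θH = CState.θ H
    end0 = fl e false false
    end1 = fl e true false
    side0 = fl e false false
    side1 = fl e false true

  IsBS : Set
  IsBS = ¬ IsLoop θH e × ¬ CState.VRel H end0 end1

  IsBP : Set
  IsBP = ¬ IsLoop θH e × CState.VRel H end0 end1

  IsOLC : Set
  IsOLC = OrientableLoop θH e × ¬ CState.BRel H side0 side1

  IsOLH : Set
  IsOLH = OrientableLoop θH e × CState.BRel H side0 side1

  IsNL : Set
  IsNL = NonOrientableLoop θH e

module _ {n : ℕ} (G : ColouredRibbonGraph n) where
  open ColouredRibbonGraph G

  endV₀ endV₁ : Fin n → ℕ
  endV₀ f = colV (fl f false false)
  endV₁ f = colV (fl f true false)

  -- classes of the boundary components touching f (its two sides) in 𝔾*/ℬ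
  endB₀ endB₁ : Fin n → ℕ
  endB₀ f = colB (fl f false false)
  endB₁ f = colB (fl f false true)

  AdjV AdjB : Fin n → ℕ → ℕ → Set
  AdjV e a b = Σ (Fin n) λ f → (f ≢ e) ×
    (((endV₀ f ≡ a) × (endV₁ f ≡ b)) ⊎ ((endV₀ f ≡ b) × (endV₁ f ≡ a)))
  AdjB e a b = Σ (Fin n) λ f → (f ≢ e) ×
    (((endB₀ f ≡ a) × (endB₁ f ≡ b)) ⊎ ((endB₀ f ≡ b) × (endB₁ f ≡ a)))

  LoopInGV BridgeInGV LoopInGdB BridgeInGdB : Fin n → Set
  LoopInGV e = endV₀ e ≡ endV₁ e
  BridgeInGV e = ¬ Star (AdjV e) (endV₀ e) (endV₁ e)
  LoopInGdB e = endB₀ e ≡ endB₁ e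
  BridgeInGdB e = ¬ Star (AdjB e) (endB₀ e) (endB₁ e)

-- Both 𝔾 / e^c and 𝔾 \ e^c are one-edge ribbon graphs.  Such a graph is
-- determined by the action of its corner map on the four flags of e, which is
-- θ₂ (e is not a loop), θ₀ (an orientable loop) or θ₀ ∘ θ₂ (a non-orientable
-- loop), and by its two colourings.
--
-- Deleting e^c removes the other edges from the corner map, and e keeps the
-- corner structure found by walking around its vertex in 𝔾: 𝔾 \ e^c has the type
-- of e in 𝔾.  Contracting e^c is deleting e^c after the partial dual at e^c, and
-- the partial dual of 𝔾 at e^c is that of 𝔾* at e: 𝔾 / e^c has the type of e in
-- 𝔾* with θ₀ and θ₂ exchanged, so e is a loop of 𝔾 / e^c iff it is not an
-- orientable doop of 𝔾.
--
-- The colour classes that survive are the original ones merged along the removed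
-- edges, i.e. the components of 𝔾 / 𝒱 or 𝔾* / ℬ without e, which turns the
-- colour conditions into bridges and loops of these graphs.  The remaining
-- conjunct in each case follows from the type: a loop of 𝔾 / e^c keeps its two
-- ends in one vertex class, and unless e is an orientable loop its two sides lie
-- on one boundary component of 𝔾 \ e^c.

module Submission where

open import Defs
open import Level using (0ℓ)
open import Data.Nat using (ℕ; zero; suc; _+_; _*_; _≤_; _<_; z≤n; s≤s)
import Data.Nat.Properties as ℕ
open import Data.Nat.GeneralisedArithmetic using (iterate)
open import Data.Bool using (Bool; true; false; not; _xor_; if_then_else_)
open import Data.Bool.Properties using (not-involutive)
open import Data.Fin using (Fin; toℕ; combine; _≟_)
open import Data.Fin.Properties using (pigeonhole; combine-injective; toℕ<n)
open import Data.Product using (Σ; ∃; _×_; _,_; proj₁; proj₂)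
open import Data.Sum using (_⊎_; inj₁; inj₂; [_,_])
open import Data.Empty using (⊥; ⊥-elim)
open import Data.List using (List; []; _∷_; foldl; allFin)
open import Data.List.Membership.Propositional using (_∈_; _∉_)
open import Data.List.Membership.Propositional.Properties using (∈-filter⁺; ∈-filter⁻; ∈-allFin)
open import Data.List.Relation.Unary.Any using (here; there)
open import Data.List.Relation.Unary.All as All using (All; []; _∷_)
open import Data.List.Relation.Unary.AllPairs using ([]; _∷_)
open import Data.List.Relation.Unary.Unique.Propositional using (Unique)
open import Data.List.Relation.Unary.Unique.Propositional.Properties using (filter⁺; allFin⁺)
open import Function using (id; _∘_)
open import Function.Bundles using (_⇔_; mk⇔; Equivalence)
open import Function.Construct.Composition using (_⇔-∘_)
open import Function.Construct.Symmetry using (⇔-sym)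
open import Function.Related.TypeIsomorphisms using (¬-cong-⇔)
open import Relation.Nullary using (¬_; Dec; does; yes; no)
open import Relation.Nullary.Decidable using (¬?; _×-dec_; _⊎-dec_)
open import Relation.Binary.Core using (Rel; _⇒_)
open import Relation.Binary.Structures using (IsEquivalence)
open import Relation.Binary.PropositionalEquality
  using (_≡_; _≢_; refl; sym; trans; cong; cong₂; subst; subst₂; module ≡-Reasoning)
open import Relation.Binary.Construct.Closure.ReflexiveTransitive using (Star; ε; _◅_; _◅◅_)
import Relation.Binary.Construct.Closure.ReflexiveTransitive as Star
import Relation.Binary.Construct.Closure.Equivalence as EqClosure

module _ {A B C : Set} where

  with-side-first : ∀ {P Q : Set} → P ⇔ A → Q ⇔ B → (P → C) → (P × Q) ⇔ (C × A × B)
  with-side-first P⇔A Q⇔B side =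
    mk⇔ (λ (p , q) → side p , to P⇔A p , to Q⇔B q) (λ (_ , a , b) → from P⇔A a , from Q⇔B b)
    where open Equivalence

  with-side-last : ∀ {P Q : Set} → P ⇔ A → Q ⇔ B → (P → C) → (P × Q) ⇔ (B × A × C)
  with-side-last P⇔A Q⇔B side =
    mk⇔ (λ (p , q) → to Q⇔B q , to P⇔A p , side p) (λ (b , a , _) → from P⇔A a , from Q⇔B b)
    where open Equivalence

  with-sides : ∀ {P : Set} → P ⇔ A → (P → B) → (P → C) → P ⇔ (B × A × C)
  with-sides P⇔A side₁ side₂ = mk⇔ (λ p → side₁ p , to P⇔A p , side₂ p) (λ (_ , a , _) → from P⇔A a)
    where open Equivalence

≡⇒⇔ : ∀ {A B : Set} → A ≡ B → A ⇔ B
≡⇒⇔ refl = mk⇔ (λ a → a) (λ a → a)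

false≢true : false ≢ true
false≢true ()


-- Restricting a corner map to the alive edges

θ₂-involutive : ∀ {n} (x : Flag n) → θ₂ (θ₂ x) ≡ x
θ₂-involutive (e , i , s) = cong (λ t → e , i , t) (not-involutive s)

θ₂-injective : ∀ {n} {x y : Flag n} → θ₂ x ≡ θ₂ y → x ≡ y
θ₂-injective {x = x} {y} p = trans (sym (θ₂-involutive x)) (trans (cong θ₂ p) (θ₂-involutive y))

θ₂-fixpoint-free : ∀ {n} (x : Flag n) → θ₂ x ≢ x
θ₂-fixpoint-free (e , i , false) ()
θ₂-fixpoint-free (e , i , true) ()

iterate-suc : ∀ {A : Set} (f : A → A) x k → iterate f x (suc k) ≡ f (iterate f x k)
iterate-suc f x zero    = refl
iterate-suc f x (suc k) = iterate-suc f (f x) k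

Alive : ∀ {n} → (Fin n → Bool) → Flag n → Set
Alive alive x = alive (edgeOf x) ≡ true

Dead : ∀ {n} → (Fin n → Bool) → Flag n → Set
Dead alive x = alive (edgeOf x) ≡ false

-- One step of the search in restrictθ: across the end of a removed edge to the next corner.
cross : ∀ {n} → (Flag n → Flag n) → Flag n → Flag n
cross φ y = φ (θ₂ y)

module _ {n : ℕ} (alive : Fin n → Bool) (φ : Flag n → Flag n) where

  skip-alive : ∀ k y → Alive alive y → skip alive φ k y ≡ y
  skip-alive zero    y a = refl
  skip-alive (suc k) y a rewrite a = refl

  skip-dead : ∀ k y → Dead alive y → skip alive φ (suc k) y ≡ skip alive φ k (cross φ y)
  skip-dead k y d rewrite d = refl

  skip-fuel-irrelevant : ∀ j k y → Alive alive (iterate (cross φ) y j) → j ≤ k →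
                         skip alive φ k y ≡ skip alive φ j y
  skip-fuel-irrelevant zero    k       y a _ = skip-alive k y a
  skip-fuel-irrelevant (suc j) (suc k) y a (s≤s j≤k) with alive (edgeOf y)
  ... | true  = refl
  ... | false = skip-fuel-irrelevant j k (cross φ y) a j≤k

  record FirstAlive (k : ℕ) (y : Flag n) : Set where
    field
      steps       : ℕ
      steps≤      : steps ≤ k
      skip≡       : skip alive φ k y ≡ iterate (cross φ) y steps
      alive-there : Alive alive (iterate (cross φ) y steps)
      dead-before : ∀ i → i < steps → Dead alive (iterate (cross φ) y i)

  firstAlive : ∀ j y → Alive alive (iterate (cross φ) y j) → FirstAlive j y
  firstAlive zero y a = record
    { steps = 0 ; steps≤ = z≤n ; skip≡ = refl ; alive-there = a ; dead-before = λ _ () }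
  firstAlive (suc j) y a with alive (edgeOf y) in eq
  ... | true  = record
    { steps = 0 ; steps≤ = z≤n ; skip≡ = skip-alive (suc j) y eq ; alive-there = eq
    ; dead-before = λ _ () }
  ... | false = record
    { steps       = suc steps
    ; steps≤      = s≤s steps≤
    ; skip≡       = trans (skip-dead j y eq) skip≡
    ; alive-there = alive-there
    ; dead-before = λ { zero _ → eq ; (suc i) (s≤s i<) → dead-before i i< } }
    where open FirstAlive (firstAlive j (cross φ y) a)

bool→Fin : Bool → Fin 2
bool→Fin false = Fin.zero
bool→Fin true  = Fin.suc Fin.zero

bool→Fin-injective : ∀ {a b} → bool→Fin a ≡ bool→Fin b → a ≡ b
bool→Fin-injective {false} {false} _ = refl
bool→Fin-injective {true}  {true}  _ = refl

flagCode : ∀ {n} → Flag n → Fin (n * 4)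
flagCode (e , i , s) = combine e (combine (bool→Fin i) (bool→Fin s))

flagCode-injective : ∀ {n} {x y : Flag n} → flagCode x ≡ flagCode y → x ≡ y
flagCode-injective {x = e , i , s} {e′ , i′ , s′} p
  with refl , q ← combine-injective e _ e′ _ p
  with q₁ , q₂ ← combine-injective (bool→Fin i) _ (bool→Fin i′) _ q
  rewrite bool→Fin-injective q₁ | bool→Fin-injective q₂ = refl

module _ {A : Set} {m : ℕ} (f : A → A) (f-injective : ∀ {x y} → f x ≡ f y → x ≡ y)
         (code : A → Fin m) (code-injective : ∀ {x y} → code x ≡ code y → x ≡ y) where

  iterate-cancel : ∀ a c x → iterate f x a ≡ iterate f x (a + c) → x ≡ iterate f x c
  iterate-cancel zero    c x p = p
  iterate-cancel (suc a) c x p = iterate-cancel a c x (f-injective (begin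
    f (iterate f x a)        ≡⟨ iterate-suc f x a ⟨
    iterate f x (suc a)      ≡⟨ p ⟩
    iterate f x (suc a + c)  ≡⟨ iterate-suc f x (a + c) ⟩
    f (iterate f x (a + c))  ∎))
    where open ≡-Reasoning

  iterate-returns : ∀ x → ∃ λ d → d < m × x ≡ f (iterate f x d)
  iterate-returns x with i , j , i<j , same ← pigeonhole (ℕ.n<1+n m) (code ∘ iterate f x ∘ toℕ)
                    with d , i+1+d≡j ← ℕ.m≤n⇒∃[o]m+o≡n i<j = d , d<m , returns
    where
      i+1+d≡j′ : toℕ i + suc d ≡ toℕ j
      i+1+d≡j′ = trans (ℕ.+-suc (toℕ i) d) i+1+d≡j
      returns : x ≡ f (iterate f x d)
      returns = trans (iterate-cancel (toℕ i) (suc d) x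
                         (trans (code-injective same) (cong (iterate f x) (sym i+1+d≡j′))))
                      (iterate-suc f x d)
      d<m : d < m
      d<m = ℕ.≤-trans (ℕ.m≤n+m (suc d) (toℕ i)) (subst (_≤ m) (sym i+1+d≡j′) (ℕ.≤-pred (toℕ<n j)))

fuel : ℕ → ℕ
fuel n = 4 * n + 4

n*4≤fuel : ∀ n → n * 4 ≤ fuel n
n*4≤fuel n = subst (_≤ fuel n) (ℕ.*-comm 4 n) (ℕ.m≤m+n (4 * n) 4)

module Restriction {n : ℕ} (φ : Flag n → Flag n) (φ-involutive : ∀ x → φ (φ x) ≡ x) where

  φ-injective : ∀ {x y} → φ x ≡ φ y → x ≡ y
  φ-injective {x} {y} p = trans (sym (φ-involutive x)) (trans (cong φ p) (φ-involutive y))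

  φ-swap : ∀ {x y} → φ x ≡ y → x ≡ φ y
  φ-swap {x} p = trans (sym (φ-involutive x)) (cong φ p)

  cross-injective : ∀ {x y} → cross φ x ≡ cross φ y → x ≡ y
  cross-injective p = θ₂-injective (φ-injective p)

  cross-θ₂ : ∀ y → cross φ (θ₂ y) ≡ φ y
  cross-θ₂ y = cong φ (θ₂-involutive y)

  φ-iterate-suc : ∀ j y → φ (iterate (cross φ) y (suc j)) ≡ θ₂ (iterate (cross φ) y j)
  φ-iterate-suc j y = trans (cong φ (iterate-suc (cross φ) y j)) (φ-involutive _)

  cross-reaches-θ₂ : ∀ x → ∃ λ d → d < n * 4 × iterate (cross φ) (φ x) d ≡ θ₂ x
  cross-reaches-θ₂ x
    with d , d<n*4 , returns ← iterate-returns (cross φ) cross-injective flagCode flagCode-injective (φ x)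
    = d , d<n*4 , trans (sym (θ₂-involutive _)) (cong θ₂ (sym (φ-injective returns)))

  module _ (alive : Fin n → Bool) where

    private
      R : Flag n → Flag n
      R = restrictθ alive φ

    -- The search from φ x reaches the alive flag θ₂ x within n * 4 steps, so it never runs out of fuel.
    restrictθ-firstAlive : ∀ x → Alive alive x →
      Σ (FirstAlive alive φ (fuel n) (φ x)) λ s → FirstAlive.steps s < n * 4
    restrictθ-firstAlive x a with d , d<n*4 , reaches ← cross-reaches-θ₂ x =
      record
        { steps       = steps
        ; steps≤      = ℕ.≤-trans steps≤ d≤fuel
        ; skip≡       = trans (skip-fuel-irrelevant alive φ d (fuel n) (φ x) alive-at-d d≤fuel) skip≡
        ; alive-there = alive-there
        ; dead-before = dead-before
        } ,
      ℕ.≤-<-trans steps≤ d<n*4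
      where
        alive-at-d : Alive alive (iterate (cross φ) (φ x) d)
        alive-at-d = subst (Alive alive) (sym reaches) a
        d≤fuel : d ≤ fuel n
        d≤fuel = ℕ.≤-trans (ℕ.<⇒≤ d<n*4) (n*4≤fuel n)
        open FirstAlive (firstAlive alive φ d (φ x) alive-at-d)

    restrictθ-alive : ∀ x → Alive alive x → Alive alive (R x)
    restrictθ-alive x a with s , _ ← restrictθ-firstAlive x a =
      subst (Alive alive) (sym (FirstAlive.skip≡ s)) (FirstAlive.alive-there s)

    restrictθ-involutive : ∀ x → Alive alive x → R (R x) ≡ x
    restrictθ-involutive x a with s , steps<n*4 ← restrictθ-firstAlive x a =
      retrace (steps s) (skip≡ s) (dead-before s) steps<n*4
      where
        open FirstAlive
        y = φ x
        walk-back : ∀ k → (∀ i → i < suc k → Dead alive (iterate (cross φ) y i)) →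
                    ∀ F → k < F → skip alive φ F (θ₂ (iterate (cross φ) y k)) ≡ x
        walk-back zero dead (suc F) _ =
          trans (skip-dead alive φ F (θ₂ y) (dead 0 (s≤s z≤n)))
                (trans (cong (skip alive φ F) (trans (cross-θ₂ y) (φ-involutive x)))
                       (skip-alive alive φ F x a))
        walk-back (suc k) dead (suc F) (s≤s k<F) =
          trans (skip-dead alive φ F _ (dead (suc k) ℕ.≤-refl))
                (trans (cong (skip alive φ F) (trans (cross-θ₂ _) (φ-iterate-suc k y)))
                       (walk-back k (λ i i< → dead i (ℕ.m<n⇒m<1+n i<)) F k<F))
        retrace : ∀ m → R x ≡ iterate (cross φ) y m →
                  (∀ i → i < m → Dead alive (iterate (cross φ) y i)) → m < n * 4 → R (R x) ≡ x
        retrace zero    Rx≡ _ _ =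
          trans (cong R Rx≡) (trans (cong (skip alive φ (fuel n)) (φ-involutive x))
                                    (skip-alive alive φ (fuel n) x a))
        retrace (suc m) Rx≡ dead m<n*4 =
          trans (cong R Rx≡) (trans (cong (skip alive φ (fuel n)) (φ-iterate-suc m y))
                (walk-back m dead (fuel n) (ℕ.<-≤-trans (ℕ.<-trans (ℕ.n<1+n m) m<n*4) (n*4≤fuel n))))

    module _ (φ-fixpoint-free : ∀ x → φ x ≢ x) where

      -- A search path from y ending at θ₂ y would be a palindrome, with a fixed point of θ₂ or φ in the middle.
      cross-orbit-avoids-θ₂ : ∀ d y → y ≢ θ₂ (iterate (cross φ) y d)
      cross-orbit-avoids-θ₂ zero          y p = θ₂-fixpoint-free y (sym p)
      cross-orbit-avoids-θ₂ (suc zero)    y p =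
        φ-fixpoint-free (θ₂ y) (sym (trans (cong θ₂ p) (θ₂-involutive _)))
      cross-orbit-avoids-θ₂ (suc (suc d)) y p =
        cross-orbit-avoids-θ₂ d (cross φ y)
          (trans (cong φ (trans (cong θ₂ p) (θ₂-involutive _)))
                 (trans (cong φ (iterate-suc (cross φ) (cross φ y) d)) (φ-involutive _)))

      restrictθ-fixpoint-free : ∀ x → Alive alive x → R x ≢ x
      restrictθ-fixpoint-free x a Rx≡x with s , _ ← restrictθ-firstAlive x a
        with FirstAlive.steps s | FirstAlive.skip≡ s
      ... | zero  | Rx≡ = φ-fixpoint-free x (trans (sym Rx≡) Rx≡x)
      ... | suc m | Rx≡ = cross-orbit-avoids-θ₂ m (φ x) (sym (φ-swap
        (trans (sym (iterate-suc (cross φ) (φ x) m)) (trans (sym Rx≡) Rx≡x))))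

    iterate-cross-sameVertex : ∀ k u → SameVertex φ u (iterate (cross φ) u k)
    iterate-cross-sameVertex zero    u = ε
    iterate-cross-sameVertex (suc k) u = inj₂ refl ◅ inj₁ refl ◅ iterate-cross-sameVertex k (cross φ u)

    restrictθ-sameVertex : ∀ x → Alive alive x → SameVertex φ x (R x)
    restrictθ-sameVertex x a with s , _ ← restrictθ-firstAlive x a =
      subst (SameVertex φ x) (sym (FirstAlive.skip≡ s))
            (inj₁ refl ◅ iterate-cross-sameVertex (FirstAlive.steps s) (φ x))

    sameVertex-restrictθ⇒sameVertex : ∀ {x y} → Alive alive x → SameVertex R x y → SameVertex φ x y
    sameVertex-restrictθ⇒sameVertex a ε = ε
    sameVertex-restrictθ⇒sameVertex {x} a (inj₁ refl ◅ r) =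
      restrictθ-sameVertex x a ◅◅ sameVertex-restrictθ⇒sameVertex (restrictθ-alive x a) r
    sameVertex-restrictθ⇒sameVertex a (inj₂ refl ◅ r) =
      inj₂ refl ◅ sameVertex-restrictθ⇒sameVertex a r

    data OnSearch (a : Flag n) (m : ℕ) : Flag n → Set where
      start   : OnSearch a m a
      passed  : ∀ j → j < m → OnSearch a m (iterate (cross φ) (φ a) j)
      passed′ : ∀ j → j < m → OnSearch a m (θ₂ (iterate (cross φ) (φ a) j))

    record Origin (x₀ : Flag n) : Set where
      field
        origin       : Flag n
        origin-alive : Alive alive origin
        reached      : SameVertex R x₀ origin
        search       : FirstAlive alive φ (fuel n) (φ origin)

    open Origin

    -- Every flag of a vertex lies on the search path of an alive flag that is
    -- R-connected to a given alive flag x₀ of that vertex.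
    Covered : Flag n → Flag n → Set
    Covered x₀ y = Σ (Origin x₀) λ o → OnSearch (origin o) (FirstAlive.steps (search o)) y

    covered-start : ∀ {x₀ a} → Alive alive a → SameVertex R x₀ a → Covered x₀ a
    covered-start {a = a} aa r =
      record { origin = a ; origin-alive = aa ; reached = r
             ; search = proj₁ (restrictθ-firstAlive a aa) } ,
      start

    covered-advance : ∀ {x₀} (o : Origin x₀) j → j ≤ FirstAlive.steps (search o) →
                      Covered x₀ (iterate (cross φ) (φ (origin o)) j)
    covered-advance o j j≤ with ℕ.m≤n⇒m<n∨m≡n j≤
    ... | inj₁ j<   = o , passed j j<
    ... | inj₂ refl = subst (Covered _) (FirstAlive.skip≡ (search o))
                        (covered-start (restrictθ-alive (origin o) (origin-alive o))
                                       (reached o ◅◅ (inj₁ refl ◅ ε)))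

    covered-θ₂ : ∀ {x₀ y} → Covered x₀ y → Covered x₀ (θ₂ y)
    covered-θ₂ (o , start)        = covered-start (origin-alive o) (reached o ◅◅ (inj₂ refl ◅ ε))
    covered-θ₂ (o , passed j j<)  = o , passed′ j j<
    covered-θ₂ (o , passed′ j j<) = o , subst (OnSearch _ _) (sym (θ₂-involutive _)) (passed j j<)

    covered-φ : ∀ {x₀ y} → Covered x₀ y → Covered x₀ (φ y)
    covered-φ (o , start)             = covered-advance o 0 z≤n
    covered-φ (o , passed zero _)     = subst (Covered _) (sym (φ-involutive _)) (o , start)
    covered-φ (o , passed (suc j) j<) = subst (Covered _) (sym (φ-iterate-suc j _))
                                          (o , passed′ j (ℕ.<-trans (ℕ.n<1+n j) j<))
    covered-φ (o , passed′ j j<)      = subst (Covered _) (iterate-suc (cross φ) _ j)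
                                          (covered-advance o (suc j) j<)

    covered-along : ∀ {x₀ y z} → Covered x₀ y → SameVertex φ y z → Covered x₀ z
    covered-along c ε                = c
    covered-along c (inj₁ refl ◅ r) = covered-along (covered-φ c) r
    covered-along c (inj₂ refl ◅ r) = covered-along (covered-θ₂ c) r

    alive-on-search : ∀ {a m y} → OnSearch a m y → Alive alive y →
                      (∀ i → i < m → Dead alive (iterate (cross φ) (φ a) i)) → y ≡ a
    alive-on-search start          _  _    = refl
    alive-on-search (passed j j<)  ay dead with () ← trans (sym ay) (dead j j<)
    alive-on-search (passed′ j j<) ay dead with () ← trans (sym ay) (dead j j<)

    sameVertex⇒sameVertex-restrictθ : ∀ {x y} → Alive alive x → Alive alive y →
                                      SameVertex φ x y → SameVertex R x y
    sameVertex⇒sameVertex-restrictθ ax ay r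
      with o , on ← covered-along (covered-start ax ε) r =
      subst (SameVertex R _) (sym (alive-on-search on ay (FirstAlive.dead-before (search o))))
            (reached o)

σAt-edgeOf : ∀ {n} (f : Fin n) x → edgeOf (σAt f x) ≡ edgeOf x
σAt-edgeOf f x with does (f ≟ edgeOf x)
... | true  = refl
... | false = refl

σAt-other : ∀ {n} (f : Fin n) x → f ≢ edgeOf x → σAt f x ≡ x
σAt-other f x f≢ with f ≟ edgeOf x
... | yes f≡ = ⊥-elim (f≢ f≡)
... | no _   = refl

σAt-same : ∀ {n} (f : Fin n) x → f ≡ edgeOf x → σAt f x ≡ σ x
σAt-same f x f≡ with f ≟ edgeOf x
... | yes _  = refl
... | no f≢  = ⊥-elim (f≢ f≡)

σAt-involutive : ∀ {n} (f : Fin n) x → σAt f (σAt f x) ≡ x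
σAt-involutive f x with f ≟ edgeOf x
... | yes f≡ = σAt-same f (σ x) f≡
... | no f≢  = σAt-other f x f≢

skip-cong : ∀ {n} {α β : Fin n → Bool} {φ ψ : Flag n → Flag n} →
            (∀ f → α f ≡ β f) → (∀ z → φ z ≡ ψ z) → ∀ k y → skip α φ k y ≡ skip β ψ k y
skip-cong α≗β φ≗ψ zero    y = refl
skip-cong {ψ = ψ} α≗β φ≗ψ (suc k) y
  rewrite α≗β (edgeOf y) | φ≗ψ (θ₂ y) | skip-cong α≗β φ≗ψ k (ψ (θ₂ y)) = refl

restrictθ-cong : ∀ {n} {α β : Fin n → Bool} {φ ψ : Flag n → Flag n} →
                 (∀ f → α f ≡ β f) → (∀ z → φ z ≡ ψ z) → ∀ x → restrictθ α φ x ≡ restrictθ β ψ x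
restrictθ-cong {n} {α} {β} {φ} {ψ} α≗β φ≗ψ x =
  trans (cong (skip α φ (fuel n)) (φ≗ψ x)) (skip-cong α≗β φ≗ψ (fuel n) (ψ x))

module _ {n} (alive : Fin n → Bool) (f : Fin n) (f-alive : alive f ≡ true) (φ : Flag n → Flag n) where

  private
    φᶠ : Flag n → Flag n
    φᶠ z = σAt f (φ (σAt f z))

    f≢dead : ∀ y → Dead alive y → f ≢ edgeOf y
    f≢dead y dead refl with () ← trans (sym dead) f-alive

  σAt-skip : ∀ k y → σAt f (skip alive φ k y) ≡ skip alive φᶠ k (σAt f y)
  σAt-skip zero    y = refl
  σAt-skip (suc k) y with alive (edgeOf y) in y-alive
  ... | true  = sym (skip-alive alive φᶠ (suc k) (σAt f y) (trans (cong alive (σAt-edgeOf f y)) y-alive))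
  ... | false = begin
    σAt f (skip alive φ k (cross φ y))          ≡⟨ σAt-skip k (cross φ y) ⟩
    skip alive φᶠ k (σAt f (φ (θ₂ y)))          ≡⟨ cong (λ t → skip alive φᶠ k (σAt f (φ t)))
                                                        (sym (σAt-other f (θ₂ y) (f≢dead y y-alive))) ⟩
    skip alive φᶠ k (cross φᶠ y)                ≡⟨ skip-dead alive φᶠ k y y-alive ⟨
    skip alive φᶠ (suc k) y                     ≡⟨ cong (skip alive φᶠ (suc k))
                                                        (σAt-other f y (f≢dead y y-alive)) ⟨
    skip alive φᶠ (suc k) (σAt f y)             ∎
    where open ≡-Reasoning

  σAt-restrictθ : ∀ x → σAt f (restrictθ alive φ (σAt f x)) ≡ restrictθ alive φᶠ x
  σAt-restrictθ x = σAt-skip (fuel n) (φ (σAt f x))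

module _ {n} {α₁ α₂ : Fin n → Bool} (α₂⊆α₁ : ∀ {f} → α₂ f ≡ true → α₁ f ≡ true)
         (φ : Flag n → Flag n) (φ-involutive : ∀ x → φ (φ x) ≡ x)
         (ψ : Flag n → Flag n) (ψ≗ : ∀ z → Alive α₁ z → ψ z ≡ restrictθ α₁ φ z) where

  private
    α₂-alive-skip : ∀ k₁ k₂ k y → Alive α₂ y →
                    skip α₂ ψ k₂ (skip α₁ φ k₁ y) ≡ skip α₂ φ k y
    α₂-alive-skip k₁ k₂ k y a =
      trans (cong (skip α₂ ψ k₂) (skip-alive α₁ φ k₁ y (α₂⊆α₁ a)))
            (trans (skip-alive α₂ ψ k₂ y a) (sym (skip-alive α₂ φ k y a)))

  skip-skip : ∀ d y {k₁ k₂ k} → Alive α₂ (iterate (cross φ) y d) →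
              d ≤ fuel n → d ≤ k₁ → d < k₂ → d ≤ k →
              skip α₂ ψ k₂ (skip α₁ φ k₁ y) ≡ skip α₂ φ k y
  skip-skip zero y {k₁} {k₂} {k} a _ _ _ _ = α₂-alive-skip k₁ k₂ k y a
  skip-skip (suc d) y {suc k₁} {suc k₂} {suc k} a d≤fuel (s≤s d≤k₁) (s≤s d<k₂) (s≤s d≤k) =
    by-cases (α₂ (edgeOf y)) (α₁ (edgeOf y)) refl refl
    where
      open ≡-Reasoning
      d≤fuel′ = ℕ.≤-trans (ℕ.n≤1+n d) d≤fuel
      by-cases : ∀ b₂ b₁ → α₂ (edgeOf y) ≡ b₂ → α₁ (edgeOf y) ≡ b₁ →
                 skip α₂ ψ (suc k₂) (skip α₁ φ (suc k₁) y) ≡ skip α₂ φ (suc k) y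
      by-cases true  _     y₂ _  = α₂-alive-skip (suc k₁) (suc k₂) (suc k) y y₂
      by-cases false true  y₂ y₁ = begin
        skip α₂ ψ (suc k₂) (skip α₁ φ (suc k₁) y)     ≡⟨ cong (skip α₂ ψ (suc k₂)) (skip-alive α₁ φ (suc k₁) y y₁) ⟩
        skip α₂ ψ (suc k₂) y                          ≡⟨ skip-dead α₂ ψ k₂ y y₂ ⟩
        skip α₂ ψ k₂ (ψ (θ₂ y))                       ≡⟨ cong (skip α₂ ψ k₂) (ψ≗ (θ₂ y) y₁) ⟩
        skip α₂ ψ k₂ (skip α₁ φ (fuel n) (cross φ y)) ≡⟨ skip-skip d (cross φ y) {fuel n} {k₂} {k} a d≤fuel′ d≤fuel′ d<k₂ d≤k ⟩
        skip α₂ φ k (cross φ y)                       ≡⟨ skip-dead α₂ φ k y y₂ ⟨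
        skip α₂ φ (suc k) y                           ∎
      by-cases false false y₂ y₁ = begin
        skip α₂ ψ (suc k₂) (skip α₁ φ (suc k₁) y)     ≡⟨ cong (skip α₂ ψ (suc k₂)) (skip-dead α₁ φ k₁ y y₁) ⟩
        skip α₂ ψ (suc k₂) (skip α₁ φ k₁ (cross φ y)) ≡⟨ skip-skip d (cross φ y) {k₁} {suc k₂} {k} a d≤fuel′ d≤k₁ (ℕ.m<n⇒m<1+n d<k₂) d≤k ⟩
        skip α₂ φ k (cross φ y)                       ≡⟨ skip-dead α₂ φ k y y₂ ⟨
        skip α₂ φ (suc k) y                           ∎

  restrictθ-restrictθ : ∀ x → Alive α₂ x → restrictθ α₂ ψ x ≡ restrictθ α₂ φ x
  restrictθ-restrictθ x a with d , d<n*4 , reaches ← Restriction.cross-reaches-θ₂ φ φ-involutive x =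
    trans (cong (skip α₂ ψ (fuel n)) (ψ≗ x (α₂⊆α₁ a)))
          (skip-skip d (φ x) (subst (Alive α₂) (sym reaches) a) d≤fuel d≤fuel
                     (ℕ.<-≤-trans d<n*4 (n*4≤fuel n)) d≤fuel)
    where d≤fuel = ℕ.≤-trans (ℕ.<⇒≤ d<n*4) (n*4≤fuel n)

module _ {n : ℕ} {Q : Rel (Flag n) 0ℓ} (Q-equiv : IsEquivalence Q) (alive : Fin n → Bool)
         (ψ : Flag n → Flag n) (ψ-within : ∀ x → Q x (ψ x))
         (dead-within : ∀ y → Dead alive y → Q y (θ₂ y)) where

  open IsEquivalence Q-equiv using () renaming (refl to Q-refl; trans to Q-trans)

  skip-within : ∀ k y → Q y (skip alive ψ k y)
  skip-within zero    y = Q-refl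
  skip-within (suc k) y = by-cases (alive (edgeOf y)) refl
    where
      by-cases : ∀ b → alive (edgeOf y) ≡ b → Q y (skip alive ψ (suc k) y)
      by-cases true  a = subst (Q y) (sym (skip-alive alive ψ (suc k) y a)) Q-refl
      by-cases false d = subst (Q y) (sym (skip-dead alive ψ k y d))
        (Q-trans (dead-within y d) (Q-trans (ψ-within (θ₂ y)) (skip-within k (cross ψ y))))

  restrictθ-within : ∀ x → Q x (restrictθ alive ψ x)
  restrictθ-within x = Q-trans (ψ-within x) (skip-within (fuel n) (ψ x))

sameVertex-dual⇒sameFace : ∀ {n} {φ : Flag n → Flag n} {x y} → SameVertex (dualθ φ) x y → SameFace φ (σ x) (σ y)
sameVertex-dual⇒sameFace ε               = ε
sameVertex-dual⇒sameFace (inj₁ refl ◅ r) = inj₁ refl ◅ sameVertex-dual⇒sameFace r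
sameVertex-dual⇒sameFace (inj₂ refl ◅ r) = inj₂ refl ◅ sameVertex-dual⇒sameFace r


-- Removing a list of edges

kill-self : ∀ {n} (f : Fin n) alive → kill f alive f ≡ false
kill-self f alive with f ≟ f
... | yes _  = refl
... | no f≢f = ⊥-elim (f≢f refl)

kill-other : ∀ {n} (f : Fin n) alive {g} → f ≢ g → kill f alive g ≡ alive g
kill-other f alive {g} f≢g with f ≟ g
... | yes f≡g = ⊥-elim (f≢g f≡g)
... | no _    = refl

kill-dead : ∀ {n} (f : Fin n) alive {g} → alive g ≡ false → kill f alive g ≡ false
kill-dead f alive {g} dead with does (f ≟ g)
... | true  = refl
... | false = dead

kill-alive : ∀ {n} (f : Fin n) alive {g} → kill f alive g ≡ true → alive g ≡ true
kill-alive f alive {g} a with does (f ≟ g)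
... | false = a

module Process {n : ℕ} (step : Fin n → CState n → CState n)
               (step-alive : ∀ f S → CState.alive (step f S) ≡ kill f (CState.alive S)) where

  process : CState n → List (Fin n) → CState n
  process S L = foldl (λ S f → step f S) S L

  private
    step-kill : ∀ f S g → CState.alive (step f S) g ≡ kill f (CState.alive S) g
    step-kill f S g = cong (λ α → α g) (step-alive f S)

  process-dead : ∀ L S {g} → CState.alive S g ≡ false → CState.alive (process S L) g ≡ false
  process-dead []      S dead = dead
  process-dead (f ∷ L) S dead =
    process-dead L (step f S) (trans (step-kill f S _) (kill-dead f (CState.alive S) dead))

  process-∈ : ∀ L S {g} → g ∈ L → CState.alive (process S L) g ≡ false
  process-∈ (f ∷ L) S (here refl) =
    process-dead L (step f S) (trans (step-kill f S f) (kill-self f (CState.alive S)))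
  process-∈ (f ∷ L) S (there g∈L) = process-∈ L (step f S) g∈L

  process-∉ : ∀ L S {g} → g ∉ L → CState.alive (process S L) g ≡ CState.alive S g
  process-∉ []      S g∉L = refl
  process-∉ (f ∷ L) S g∉L =
    trans (process-∉ L (step f S) (g∉L ∘ there))
          (trans (step-kill f S _) (kill-other f (CState.alive S) (λ f≡g → g∉L (here (sym f≡g)))))

deleteEdges contractEdges : ∀ {n} → CState n → List (Fin n) → CState n
deleteEdges   = Process.process deleteEdge (λ _ _ → refl)
contractEdges = Process.process contractEdge (λ _ _ → refl)

mergeEdges : ∀ {n} → List (Fin n) → Rel (Flag n) 0ℓ → Rel (Flag n) 0ℓ
mergeEdges []      R = R
mergeEdges (f ∷ L) R = mergeEdges L (EqClosure.EqClosure (R ∪R SameEdge f))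

module _ {n : ℕ} where

  mergeEdges-least : ∀ L {R Q : Rel (Flag n) 0ℓ} → IsEquivalence Q → R ⇒ Q →
                     (∀ {f} → f ∈ L → SameEdge f ⇒ Q) → mergeEdges L R ⇒ Q
  mergeEdges-least []      Q-equiv R⇒Q edges⇒Q = R⇒Q
  mergeEdges-least (f ∷ L) Q-equiv R⇒Q edges⇒Q =
    mergeEdges-least L Q-equiv (EqClosure.fold Q-equiv [ R⇒Q , edges⇒Q (here refl) ]) (edges⇒Q ∘ there)

  mergeEdges-⊇ : ∀ L {R : Rel (Flag n) 0ℓ} → R ⇒ mergeEdges L R
  mergeEdges-⊇ []      = id
  mergeEdges-⊇ (f ∷ L) = mergeEdges-⊇ L ∘ EqClosure.return ∘ inj₁

  mergeEdges-sameEdge : ∀ L {R : Rel (Flag n) 0ℓ} {f} → f ∈ L → SameEdge f ⇒ mergeEdges L R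
  mergeEdges-sameEdge (f ∷ L) (here refl) = mergeEdges-⊇ L ∘ EqClosure.return ∘ inj₂
  mergeEdges-sameEdge (g ∷ L) (there f∈L) = mergeEdges-sameEdge L f∈L

  mergeEdges-isEquivalence : ∀ L {R : Rel (Flag n) 0ℓ} → IsEquivalence R → IsEquivalence (mergeEdges L R)
  mergeEdges-isEquivalence []      R-equiv = R-equiv
  mergeEdges-isEquivalence (f ∷ L) R-equiv = mergeEdges-isEquivalence L (EqClosure.isEquivalence _)

  deleteEdges-VRel : ∀ L (S : CState n) → CState.VRel (deleteEdges S L) ≡ CState.VRel S
  deleteEdges-VRel []      S = refl
  deleteEdges-VRel (f ∷ L) S = deleteEdges-VRel L (deleteEdge f S)

  deleteEdges-BRel : ∀ L (S : CState n) → CState.BRel (deleteEdges S L) ≡ mergeEdges L (CState.BRel S)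
  deleteEdges-BRel []      S = refl
  deleteEdges-BRel (f ∷ L) S = deleteEdges-BRel L (deleteEdge f S)

  contractEdges-VRel : ∀ L (S : CState n) → CState.VRel (contractEdges S L) ≡ mergeEdges L (CState.VRel S)
  contractEdges-VRel []      S = refl
  contractEdges-VRel (f ∷ L) S = contractEdges-VRel L (contractEdge f S)

  contractEdges-BRel : ∀ L (S : CState n) → CState.BRel (contractEdges S L) ≡ CState.BRel S
  contractEdges-BRel []      S = refl
  contractEdges-BRel (f ∷ L) S = contractEdges-BRel L (contractEdge f S)

module _ {n : ℕ} where

  RemovedFrom : (Flag n → Flag n) → CState n → Set
  RemovedFrom φ S = ∀ z → Alive (CState.alive S) z → CState.θ S z ≡ restrictθ (CState.alive S) φ z

  toState-removedFrom : (G : ColouredRibbonGraph n) →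
                        RemovedFrom (ColouredRibbonGraph.θ G) (toState G)
  toState-removedFrom G z _ = sym (skip-alive _ (ColouredRibbonGraph.θ G) (fuel n) _ refl)

  deleteEdges-removedFrom : ∀ {φ} → (∀ x → φ (φ x) ≡ x) →
                            ∀ L S → RemovedFrom φ S → RemovedFrom φ (deleteEdges S L)
  deleteEdges-removedFrom φ-involutive []      S S-removed = S-removed
  deleteEdges-removedFrom {φ} φ-involutive (f ∷ L) S S-removed =
    deleteEdges-removedFrom {φ} φ-involutive L (deleteEdge f S)
      (restrictθ-restrictθ (kill-alive f (CState.alive S)) φ φ-involutive (CState.θ S) S-removed)

  σDead : (Fin n → Bool) → Flag n → Flag n
  σDead alive x = if alive (edgeOf x) then x else σ x

  partialDual : (Fin n → Bool) → (Flag n → Flag n) → Flag n → Flag n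
  partialDual alive φ x = σDead alive (φ (σDead alive x))

  σDead-involutive : ∀ alive x → σDead alive (σDead alive x) ≡ x
  σDead-involutive alive x with alive (edgeOf x) in a
  ... | true  rewrite a = refl
  ... | false rewrite a = refl

  partialDual-involutive : ∀ alive {φ} → (∀ x → φ (φ x) ≡ x) → ∀ x → partialDual alive φ (partialDual alive φ x) ≡ x
  partialDual-involutive alive {φ} φ-involutive x =
    trans (cong (σDead alive ∘ φ) (σDead-involutive alive _))
          (trans (cong (σDead alive) (φ-involutive _)) (σDead-involutive alive x))

  σDead-σAt : ∀ alive f → alive f ≡ true → ∀ x → σDead alive (σAt f x) ≡ σDead (kill f alive) x
  σDead-σAt alive f f-alive x with f ≟ edgeOf x
  ... | yes refl rewrite f-alive = refl
  ... | no _     = refl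

  σAt-σDead : ∀ alive f → alive f ≡ true → ∀ x → σAt f (σDead alive x) ≡ σDead (kill f alive) x
  σAt-σDead alive f f-alive x with f ≟ edgeOf x
  ... | yes refl rewrite f-alive = σAt-same f x refl
  ... | no f≢ with alive (edgeOf x)
  ...   | true  = σAt-other f x f≢
  ...   | false = σAt-other f (σ x) f≢

  σAt-partialDual : ∀ alive f → alive f ≡ true → ∀ φ x →
                    σAt f (partialDual alive φ (σAt f x)) ≡ partialDual (kill f alive) φ x
  σAt-partialDual alive f f-alive φ x =
    trans (σAt-σDead alive f f-alive _) (cong (σDead (kill f alive) ∘ φ) (σDead-σAt alive f f-alive x))

  -- Contraction is deletion after the partial dual, so after contracting the dead edges of S
  -- the corner map is that of the partial dual of φ at them, with them removed.
  contractEdge-removedFrom : ∀ {φ} → (∀ x → φ (φ x) ≡ x) → ∀ f S → CState.alive S f ≡ true →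
                             RemovedFrom (partialDual (CState.alive S) φ) S →
                             RemovedFrom (partialDual (CState.alive (contractEdge f S)) φ) (contractEdge f S)
  contractEdge-removedFrom {φ} φ-involutive f S f-alive S-removed z z-alive =
    trans (restrictθ-restrictθ (kill-alive f α) χ χ-involutive ψ ψ≗ z z-alive)
          (restrictθ-cong (λ _ → refl) (σAt-partialDual α f f-alive φ) z)
    where
      α = CState.alive S
      χ ψ : Flag n → Flag n
      χ x = σAt f (partialDual α φ (σAt f x))
      ψ x = σAt f (CState.θ S (σAt f x))
      χ-involutive : ∀ x → χ (χ x) ≡ x
      χ-involutive x =
        trans (cong (σAt f ∘ partialDual α φ) (σAt-involutive f _))
              (trans (cong (σAt f) (partialDual-involutive α {φ} φ-involutive _)) (σAt-involutive f x))
      ψ≗ : ∀ x → Alive α x → ψ x ≡ restrictθ α χ x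
      ψ≗ x a = trans (cong (σAt f) (S-removed (σAt f x) (trans (cong α (σAt-edgeOf f x)) a)))
                     (σAt-restrictθ α f f-alive (partialDual α φ) x)

  contractEdges-removedFrom : ∀ {φ} → (∀ x → φ (φ x) ≡ x) → ∀ L S → Unique L →
                              All (λ f → CState.alive S f ≡ true) L →
                              RemovedFrom (partialDual (CState.alive S) φ) S →
                              RemovedFrom (partialDual (CState.alive (contractEdges S L)) φ) (contractEdges S L)
  contractEdges-removedFrom φ-involutive []      S _ _ S-removed = S-removed
  contractEdges-removedFrom {φ} φ-involutive (f ∷ L) S (f∉L ∷ L-unique) (f-alive ∷ L-alive) S-removed =
    contractEdges-removedFrom {φ} φ-involutive L (contractEdge f S) L-unique (still-alive f∉L L-alive)
      (contractEdge-removedFrom {φ} φ-involutive f S f-alive S-removed)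
    where
      still-alive : ∀ {L} → All (f ≢_) L → All (λ g → CState.alive S g ≡ true) L →
                    All (λ g → CState.alive (contractEdge f S) g ≡ true) L
      still-alive []            []            = []
      still-alive (f≢g ∷ f≢L) (g-alive ∷ L-alive) =
        trans (kill-other f (CState.alive S) f≢g) g-alive ∷ still-alive f≢L L-alive

-- Quotient graphs

-- The graph on colour classes whose edges are the edges of a ribbon graph:
-- end f b are the flags of f standing for its two ends, and every flag of f
-- has the colour of one of them.
module QuotientGraph {n : ℕ} (col : Flag n → ℕ) (end : Fin n → Bool → Flag n)
                     (end-edgeOf : ∀ f b → edgeOf (end f b) ≡ f)
                     (col-end : ∀ f i s → Σ Bool λ b → col (fl f i s) ≡ col (end f b)) where

  endCol : Fin n → Bool → ℕ
  endCol f b = col (end f b)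

  Joins : Fin n → ℕ → ℕ → Set
  Joins f a b = ((endCol f false ≡ a) × (endCol f true ≡ b)) ⊎ ((endCol f false ≡ b) × (endCol f true ≡ a))

  Link : List (Fin n) → ℕ → ℕ → Set
  Link L a b = Σ (Fin n) λ f → f ∈ L × Joins f a b

  SameColour : Flag n → Flag n → Set
  SameColour x y = col x ≡ col y

  joins-sym : ∀ {f a b} → Joins f a b → Joins f b a
  joins-sym (inj₁ p) = inj₂ p
  joins-sym (inj₂ p) = inj₁ p

  link-ends : ∀ {L f} → f ∈ L → ∀ b c → Star (Link L) (endCol f b) (endCol f c)
  link-ends f∈L false false = ε
  link-ends f∈L true  true  = ε
  link-ends f∈L false true  = (_ , f∈L , inj₁ (refl , refl)) ◅ ε
  link-ends f∈L true  false = (_ , f∈L , inj₂ (refl , refl)) ◅ ε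

  mergeEdges⇒connected : ∀ L {x y} → mergeEdges L SameColour x y → Star (Link L) (col x) (col y)
  mergeEdges⇒connected L = mergeEdges-least L connected-isEquivalence
    (λ x≡y → subst (Star (Link L) _) x≡y ε) edge-connected
    where
      connected-isEquivalence : IsEquivalence (λ x y → Star (Link L) (col x) (col y))
      connected-isEquivalence = record
        { refl = ε ; sym = Star.reverse (λ (f , f∈L , j) → f , f∈L , joins-sym j) ; trans = _◅◅_ }
      edge-connected : ∀ {f} → f ∈ L → ∀ {x y} → SameEdge f x y → Star (Link L) (col x) (col y)
      edge-connected f∈L {_ , i , s} {_ , j , t} (refl , refl)
        with b , x≡ ← col-end _ i s | c , y≡ ← col-end _ j t =
        subst₂ (Star (Link L)) (sym x≡) (sym y≡) (link-ends f∈L b c)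

  sameColour-isEquivalence : IsEquivalence SameColour
  sameColour-isEquivalence = record { refl = refl ; sym = sym ; trans = trans }

  private
    across : ∀ L {f} → f ∈ L → ∀ u v {x y} → SameColour x (end f u) →
             mergeEdges L SameColour (end f v) y → mergeEdges L SameColour x y
    across L {f} f∈L u v x~ rest =
      M.trans (mergeEdges-⊇ L x~) (M.trans (mergeEdges-sameEdge L f∈L (end-edgeOf f u , end-edgeOf f v)) rest)
      where module M = IsEquivalence (mergeEdges-isEquivalence L sameColour-isEquivalence)

  connected⇒mergeEdges : ∀ L {a b} → Star (Link L) a b →
                         ∀ {x y} → col x ≡ a → col y ≡ b → mergeEdges L SameColour x y
  connected⇒mergeEdges L ε x≡ y≡ = mergeEdges-⊇ L (trans x≡ (sym y≡))
  connected⇒mergeEdges L ((f , f∈L , inj₁ (p , q)) ◅ r) x≡ y≡ =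
    across L f∈L false true (trans x≡ (sym p)) (connected⇒mergeEdges L r q y≡)
  connected⇒mergeEdges L ((f , f∈L , inj₂ (p , q)) ◅ r) x≡ y≡ =
    across L f∈L true false (trans x≡ (sym q)) (connected⇒mergeEdges L r p y≡)

  private
    Via : Fin n → List (Fin n) → ℕ → ℕ → Set
    Via f L a b = Star (Link L) a b
                ⊎ (Star (Link L) a (endCol f false) × Star (Link L) (endCol f true) b)
                ⊎ (Star (Link L) a (endCol f true) × Star (Link L) (endCol f false) b)

    weaken : ∀ f L {a b} → Star (Link L) a b → Star (Link (f ∷ L)) a b
    weaken f L = Star.map (λ (g , g∈L , j) → g , there g∈L , j)

    -- A walk using the edge f can be shortened to one using it at most once.
    split : ∀ f L {a b} → Star (Link (f ∷ L)) a b → Via f L a b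
    split f L ε = inj₁ ε
    split f L ((g , there g∈L , j) ◅ r) with split f L r
    ... | inj₁ s              = inj₁ ((g , g∈L , j) ◅ s)
    ... | inj₂ (inj₁ (s , t)) = inj₂ (inj₁ ((g , g∈L , j) ◅ s , t))
    ... | inj₂ (inj₂ (s , t)) = inj₂ (inj₂ ((g , g∈L , j) ◅ s , t))
    split f L ((f , here refl , inj₁ (refl , refl)) ◅ r) with split f L r
    ... | inj₁ s              = inj₂ (inj₁ (ε , s))
    ... | inj₂ (inj₁ (s , t)) = inj₂ (inj₁ (ε , t))
    ... | inj₂ (inj₂ (s , t)) = inj₁ t
    split f L ((f , here refl , inj₂ (refl , refl)) ◅ r) with split f L r
    ... | inj₁ s              = inj₂ (inj₂ (ε , s))
    ... | inj₂ (inj₁ (s , t)) = inj₁ t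
    ... | inj₂ (inj₂ (s , t)) = inj₂ (inj₂ (ε , t))

    join : ∀ f L {a b} → Via f L a b → Star (Link (f ∷ L)) a b
    join f L (inj₁ s) = weaken f L s
    join f L (inj₂ (inj₁ (s , t))) = weaken f L s ◅◅ ((f , here refl , inj₁ (refl , refl)) ◅ weaken f L t)
    join f L (inj₂ (inj₂ (s , t))) = weaken f L s ◅◅ ((f , here refl , inj₂ (refl , refl)) ◅ weaken f L t)

  connected? : ∀ L a b → Dec (Star (Link L) a b)
  connected? [] a b with a ℕ.≟ b
  ... | yes refl = yes ε
  ... | no a≢b   = no λ { ε → a≢b refl ; ((_ , () , _) ◅ _) }
  connected? (f ∷ L) a b
    with connected? L a b
         ⊎-dec (connected? L a (endCol f false) ×-dec connected? L (endCol f true) b)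
         ⊎-dec (connected? L a (endCol f true) ×-dec connected? L (endCol f false) b)
  ... | yes via = yes (join f L via)
  ... | no ¬via = no (¬via ∘ split f L)

-- One-edge ribbon graphs

-- A one-edge ribbon graph is separate, untwisted or twisted according as its corner
-- map acts on the flags e , p (p : Bool × Bool) as θ₂, θ₀ or θ₀ ∘ θ₂.

data Shape : Set where
  separate untwisted twisted : Shape

shapeFlip : Shape → Bool × Bool → Bool × Bool
shapeFlip separate  (i , s) = i , not s
shapeFlip untwisted (i , s) = not i , s
shapeFlip twisted   (i , s) = not i , not s

shapeFlip-involutive : ∀ sh p → shapeFlip sh (shapeFlip sh p) ≡ p
shapeFlip-involutive separate  (i , s) = cong (i ,_) (not-involutive s)
shapeFlip-involutive untwisted (i , s) = cong (_, s) (not-involutive i)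
shapeFlip-involutive twisted   (i , s) = cong₂ _,_ (not-involutive i) (not-involutive s)

-- Conjugation by σ exchanges the coordinates, hence θ₀ and θ₂.
dualShape : Shape → Shape
dualShape separate  = untwisted
dualShape untwisted = separate
dualShape twisted   = twisted

dualShape-⇔ : ∀ {a b} → (dualShape a ≡ dualShape b) ⇔ (a ≡ b)
dualShape-⇔ = mk⇔ (λ eq → trans (sym (dualShape-involutive _)) (trans (cong dualShape eq) (dualShape-involutive _)))
                  (cong dualShape)
  where
    dualShape-involutive : ∀ sh → dualShape (dualShape sh) ≡ sh
    dualShape-involutive separate  = refl
    dualShape-involutive untwisted = refl
    dualShape-involutive twisted   = refl

module _ (g : Bool × Bool → Bool × Bool) (g-involutive : ∀ p → g (g p) ≡ p)
         (g-fixpoint-free : ∀ p → g p ≢ p) where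

  private
    Covers : Shape → Bool × Bool → Set
    Covers sh u = ∀ p → p ≡ (false , false) ⊎ p ≡ shapeFlip sh (false , false) ⊎ p ≡ u ⊎ p ≡ shapeFlip sh u

    -- the fourth flag is paired with the third
    partner : ∀ sh u → Covers sh u → u ≢ (false , false) → u ≢ shapeFlip sh (false , false) →
              g (false , false) ≡ shapeFlip sh (false , false) → g u ≡ shapeFlip sh u
    partner sh u covers u≢₀ u≢₁ g₀ with covers (g u)
    ... | inj₁ gu≡₀                = ⊥-elim (u≢₁ (trans (sym (g-involutive u)) (trans (cong g gu≡₀) g₀)))
    ... | inj₂ (inj₁ gu≡₁)         = ⊥-elim (u≢₀ (trans (sym (g-involutive u))
                                       (trans (cong g gu≡₁) (trans (cong g (sym g₀)) (g-involutive _)))))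
    ... | inj₂ (inj₂ (inj₁ gu≡u))  = ⊥-elim (g-fixpoint-free u gu≡u)
    ... | inj₂ (inj₂ (inj₂ gu≡v))  = gu≡v

    flipped : ∀ {sh q} → g q ≡ shapeFlip sh q → g (shapeFlip sh q) ≡ shapeFlip sh (shapeFlip sh q)
    flipped {sh} {q} gq = trans (cong g (sym gq)) (trans (g-involutive q) (sym (shapeFlip-involutive sh q)))

    determined : ∀ sh u → Covers sh u → g (false , false) ≡ shapeFlip sh (false , false) →
                 g u ≡ shapeFlip sh u → ∀ p → g p ≡ shapeFlip sh p
    determined sh u covers g₀ gu p with covers p
    ... | inj₁ refl                = g₀
    ... | inj₂ (inj₁ refl)         = flipped g₀
    ... | inj₂ (inj₂ (inj₁ refl))  = gu
    ... | inj₂ (inj₂ (inj₂ refl))  = flipped gu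

    shape-from : ∀ sh u → Covers sh u → g (false , false) ≡ shapeFlip sh (false , false) →
                 u ≢ (false , false) → u ≢ shapeFlip sh (false , false) → ∀ p → g p ≡ shapeFlip sh p
    shape-from sh u covers g₀ u≢₀ u≢₁ = determined sh u covers g₀ (partner sh u covers u≢₀ u≢₁ g₀)

  fixpointFreeInvolution-shape : Σ Shape λ sh → ∀ p → g p ≡ shapeFlip sh p
  fixpointFreeInvolution-shape with g (false , false) in g₀
  ... | false , false = ⊥-elim (g-fixpoint-free _ g₀)
  ... | false , true  = separate , shape-from separate (true , false) covers g₀ (λ ()) (λ ())
    where covers : Covers separate (true , false)
          covers (false , false) = inj₁ refl
          covers (false , true)  = inj₂ (inj₁ refl)
          covers (true  , false) = inj₂ (inj₂ (inj₁ refl))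
          covers (true  , true)  = inj₂ (inj₂ (inj₂ refl))
  ... | true  , false = untwisted , shape-from untwisted (false , true) covers g₀ (λ ()) (λ ())
    where covers : Covers untwisted (false , true)
          covers (false , false) = inj₁ refl
          covers (false , true)  = inj₂ (inj₂ (inj₁ refl))
          covers (true  , false) = inj₂ (inj₁ refl)
          covers (true  , true)  = inj₂ (inj₂ (inj₂ refl))
  ... | true  , true  = twisted , shape-from twisted (false , true) covers g₀ (λ ()) (λ ())
    where covers : Covers twisted (false , true)
          covers (false , false) = inj₁ refl
          covers (false , true)  = inj₂ (inj₂ (inj₁ refl))
          covers (true  , false) = inj₂ (inj₂ (inj₂ refl))
          covers (true  , true)  = inj₂ (inj₁ refl)

module OneEdge {n : ℕ} (e : Fin n) where

  record HasShape (h : Flag n → Flag n) (sh : Shape) : Set where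
    constructor hasShape⁺
    field shape≡ : ∀ p → h (e , p) ≡ (e , shapeFlip sh p)

  open HasShape public

  hasShape : (h : Flag n → Flag n) → (∀ p → edgeOf (h (e , p)) ≡ e) →
             (∀ p → h (h (e , p)) ≡ (e , p)) → (∀ p → h (e , p) ≢ (e , p)) → Σ Shape (HasShape h)
  hasShape h stays h-involutive h-fixpoint-free =
    proj₁ g-shape , hasShape⁺ λ p → trans (h≡ p) (cong (e ,_) (proj₂ g-shape p))
    where
      g : Bool × Bool → Bool × Bool
      g p = proj₂ (h (e , p))
      h≡ : ∀ p → h (e , p) ≡ (e , g p)
      h≡ p = cong (_, g p) (stays p)
      g-involutive : ∀ p → g (g p) ≡ p
      g-involutive p = cong proj₂ (trans (cong h (sym (h≡ p))) (h-involutive p))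
      g-fixpoint-free : ∀ p → g p ≢ p
      g-fixpoint-free p gp≡p = h-fixpoint-free p (trans (h≡ p) (cong (e ,_) gp≡p))
      g-shape = fixpointFreeInvolution-shape g g-involutive g-fixpoint-free

  module _ {h : Flag n → Flag n} where

    separate-not-loop : HasShape h separate → ¬ IsLoop h e
    separate-not-loop h-shape loop = false≢true (cong (proj₁ ∘ proj₂) (sym (proj₂ (along loop refl))))
      where
        along : ∀ {x y} → Star (VStep h) x y → ∀ {s} → x ≡ (e , false , s) → Σ Bool λ s′ → y ≡ (e , false , s′)
        along ε               x≡   = _ , x≡
        along (inj₁ refl ◅ r) refl = along r (shape≡ h-shape (false , _))
        along (inj₂ refl ◅ r) refl = along r refl

    shape-loop : ∀ {sh} → HasShape h sh → sh ≢ separate → IsLoop h e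
    shape-loop {separate}  h-shape sh≢ = ⊥-elim (sh≢ refl)
    shape-loop {untwisted} h-shape sh≢ = inj₁ (sym (shape≡ h-shape (false , false))) ◅ ε
    shape-loop {twisted}   h-shape sh≢ = inj₂ refl ◅ inj₁ (sym (shape≡ h-shape (false , true))) ◅ ε

    shape-orientable : ∀ {sh} → HasShape h sh → sh ≢ twisted → Orientable₁ h e
    shape-orientable {sh} h-shape sh≢ =
      parity , λ i s → not-xor i s , xor-not i s ,
                       λ eq → h-flips sh≢ i s (trans (cong parity (sym (shape≡ h-shape (i , s)))) eq)
      where
        parity : Flag n → Bool
        parity (_ , i , s) = i xor s
        not-xor : ∀ i s → (not i xor s) ≢ (i xor s)
        not-xor false false () ; not-xor false true () ; not-xor true false () ; not-xor true true ()
        xor-not : ∀ i s → (i xor not s) ≢ (i xor s)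
        xor-not false false () ; xor-not false true () ; xor-not true false () ; xor-not true true ()
        h-flips : ∀ {sh} → sh ≢ twisted → ∀ i s → parity (e , shapeFlip sh (i , s)) ≢ (i xor s)
        h-flips {separate}  _   = xor-not
        h-flips {untwisted} _   = not-xor
        h-flips {twisted}   sh≢ = ⊥-elim (sh≢ refl)

    twisted-not-orientable : HasShape h twisted → ¬ Orientable₁ h e
    twisted-not-orientable h-shape (c , proper) =
      no-three-colours (c (e , false , false)) (c (e , true , false)) (c (e , true , true))
        (λ eq → proj₁ (proper false false) (sym eq))
        (λ eq → proj₁ (proj₂ (proper true false)) (sym eq))
        (λ eq → proj₂ (proj₂ (proper false false)) (trans (cong c (shape≡ h-shape (false , false))) (sym eq)))
      where
        no-three-colours : ∀ a b c → a ≢ b → b ≢ c → a ≢ c → ⊥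
        no-three-colours false false _     a≢b _   _   = a≢b refl
        no-three-colours true  true  _     a≢b _   _   = a≢b refl
        no-three-colours false true  false _   _   a≢c = a≢c refl
        no-three-colours true  false true  _   _   a≢c = a≢c refl
        no-three-colours false true  true  _   b≢c _   = b≢c refl
        no-three-colours true  false false _   b≢c _   = b≢c refl

    hasShape-σ : ∀ {sh} → HasShape h sh → HasShape (λ x → σ (h (σ x))) (dualShape sh)
    hasShape-σ {separate}  h-shape = hasShape⁺ λ (i , s) → cong σ (shape≡ h-shape (s , i))
    hasShape-σ {untwisted} h-shape = hasShape⁺ λ (i , s) → cong σ (shape≡ h-shape (s , i))
    hasShape-σ {twisted}   h-shape = hasShape⁺ λ (i , s) → cong σ (shape≡ h-shape (s , i))

  isLoop-sameShape : ∀ {h k sh} → HasShape h sh → HasShape k sh → IsLoop h e ⇔ IsLoop k e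
  isLoop-sameShape {sh = separate}  h-shape k-shape =
    mk⇔ (⊥-elim ∘ separate-not-loop h-shape) (⊥-elim ∘ separate-not-loop k-shape)
  isLoop-sameShape {sh = untwisted} h-shape k-shape =
    mk⇔ (λ _ → shape-loop k-shape λ ()) (λ _ → shape-loop h-shape λ ())
  isLoop-sameShape {sh = twisted}   h-shape k-shape =
    mk⇔ (λ _ → shape-loop k-shape λ ()) (λ _ → shape-loop h-shape λ ())

  record LocalShape (h : Flag n → Flag n) (sh : Shape) : Set where
    field
      isLoop⇔ : IsLoop h e ⇔ IsLoop (subθ h e) e
      local   : HasShape (subθ h e) sh

  module _ {h : Flag n → Flag n} where
    open LocalShape
    open Equivalence

    private
      loop : ∀ {sh} → LocalShape h sh → sh ≢ separate → IsLoop h e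
      loop ls sh≢ = from (isLoop⇔ ls) (shape-loop (local ls) sh≢)

    not-loop⇔separate : ∀ {sh} → LocalShape h sh → (¬ IsLoop h e) ⇔ (sh ≡ separate)
    not-loop⇔separate {separate}  ls = mk⇔ (λ _ → refl) (λ _ → separate-not-loop (local ls) ∘ to (isLoop⇔ ls))
    not-loop⇔separate {untwisted} ls = mk⇔ (λ ¬loop → ⊥-elim (¬loop (loop ls λ ()))) λ ()
    not-loop⇔separate {twisted}   ls = mk⇔ (λ ¬loop → ⊥-elim (¬loop (loop ls λ ()))) λ ()

    orientableLoop⇔untwisted : ∀ {sh} → LocalShape h sh → OrientableLoop h e ⇔ (sh ≡ untwisted)
    orientableLoop⇔untwisted {separate}  ls =
      mk⇔ (λ (l , _) → ⊥-elim (separate-not-loop (local ls) (to (isLoop⇔ ls) l))) λ ()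
    orientableLoop⇔untwisted {untwisted} ls =
      mk⇔ (λ _ → refl) (λ _ → loop ls (λ ()) , shape-orientable (local ls) λ ())
    orientableLoop⇔untwisted {twisted}   ls =
      mk⇔ (λ (_ , o) → ⊥-elim (twisted-not-orientable (local ls) o)) λ ()

    nonOrientableLoop⇔twisted : ∀ {sh} → LocalShape h sh → NonOrientableLoop h e ⇔ (sh ≡ twisted)
    nonOrientableLoop⇔twisted {separate}  ls =
      mk⇔ (λ (l , _) → ⊥-elim (separate-not-loop (local ls) (to (isLoop⇔ ls) l))) λ ()
    nonOrientableLoop⇔twisted {untwisted} ls =
      mk⇔ (λ (_ , ¬o) → ⊥-elim (¬o (shape-orientable (local ls) λ ()))) λ ()
    nonOrientableLoop⇔twisted {twisted}   ls =
      mk⇔ (λ _ → refl) (λ _ → loop ls (λ ()) , twisted-not-orientable (local ls))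

module _ {n : ℕ} (e : Fin n) where

  onlyEdge-self : onlyEdge e e ≡ true
  onlyEdge-self with e ≟ e
  ... | yes _  = refl
  ... | no e≢e = ⊥-elim (e≢e refl)

  onlyEdge-true : ∀ {f} → onlyEdge e f ≡ true → e ≡ f
  onlyEdge-true {f} only with e ≟ f
  ... | yes e≡f = e≡f

  ∈-others : ∀ {f} → e ≢ f → f ∈ others e
  ∈-others {f} = ∈-filter⁺ (λ f → ¬? (e ≟ f)) (∈-allFin f)

  ∈-others⁻ : ∀ {f} → f ∈ others e → e ≢ f
  ∈-others⁻ f∈ = proj₂ (∈-filter⁻ (λ f → ¬? (e ≟ f)) {xs = allFin n} f∈)

  others-unique : Unique (others e)
  others-unique = filter⁺ (λ f → ¬? (e ≟ f)) (allFin⁺ n)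

  process-others-alive : ∀ step step-alive S → (∀ f → CState.alive S f ≡ true) →
                         ∀ f → CState.alive (Process.process step step-alive S (others e)) f ≡ onlyEdge e f
  process-others-alive step step-alive S all-alive f with e ≟ f
  ... | yes refl = trans (Process.process-∉ step step-alive (others e) S (λ e∈ → ∈-others⁻ e∈ refl))
                         (all-alive e)
  ... | no e≢f   = Process.process-∈ step step-alive (others e) S (∈-others e≢f)

  open OneEdge e

  restrictθ-localShape : ∀ φ → (∀ x → φ (φ x) ≡ x) → (∀ x → φ x ≢ x) → Σ Shape (LocalShape φ)
  restrictθ-localShape φ φ-involutive φ-fixpoint-free = proj₁ shape , record
    { isLoop⇔ = mk⇔ (sameVertex⇒sameVertex-restrictθ only onlyEdge-self onlyEdge-self)
                    (sameVertex-restrictθ⇒sameVertex only onlyEdge-self)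
    ; local   = proj₂ shape }
    where
      open Restriction φ φ-involutive
      only = onlyEdge e
      shape = hasShape (subθ φ e)
        (λ p → sym (onlyEdge-true (restrictθ-alive only (e , p) onlyEdge-self)))
        (λ p → restrictθ-involutive only (e , p) onlyEdge-self)
        (λ p → restrictθ-fixpoint-free only φ-fixpoint-free (e , p) onlyEdge-self)

  hasShape⇒localShape : ∀ {h sh} → HasShape h sh → LocalShape h sh
  hasShape⇒localShape {h} {sh} h-shape = record { isLoop⇔ = isLoop-sameShape h-shape sub-shape ; local = sub-shape }
    where
      sub-shape : HasShape (subθ h e) sh
      sub-shape = hasShape⁺ λ p →
        trans (skip-alive (onlyEdge e) h (fuel n) (h (e , p))
                          (subst (Alive (onlyEdge e)) (sym (shape≡ h-shape p)) onlyEdge-self))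
              (shape≡ h-shape p)

module WithoutEdge {n : ℕ} (e : Fin n) (col : Flag n → ℕ) (end : Fin n → Bool → Flag n)
                   (end-edgeOf : ∀ f b → edgeOf (end f b) ≡ f)
                   (col-end : ∀ f i s → Σ Bool λ b → col (fl f i s) ≡ col (end f b)) where

  open QuotientGraph col end end-edgeOf col-end public

  Adj : ℕ → ℕ → Set
  Adj a b = Σ (Fin n) λ f → f ≢ e × Joins f a b

  private
    toLink : ∀ {a b} → Star Adj a b → Star (Link (others e)) a b
    toLink = Star.map λ (f , f≢e , j) → f , ∈-others e (f≢e ∘ sym) , j

    fromLink : ∀ {a b} → Star (Link (others e)) a b → Star Adj a b
    fromLink = Star.map λ (f , f∈ , j) → f , (∈-others⁻ e f∈ ∘ sym) , j

  merged⇔connected : ∀ {x y} → mergeEdges (others e) SameColour x y ⇔ Star Adj (col x) (col y)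
  merged⇔connected = mk⇔ (fromLink ∘ mergeEdges⇒connected (others e))
                         (λ path → connected⇒mergeEdges (others e) (toLink path) refl refl)

  connected-stable : ∀ {a b} → ¬ ¬ Star Adj a b → Star Adj a b
  connected-stable {a} {b} ¬¬path with connected? (others e) a b
  ... | yes path = fromLink path
  ... | no ¬path = ⊥-elim (¬¬path (¬path ∘ toLink))

module Characterisation {n : ℕ} (G : ColouredRibbonGraph n) (e : Fin n) where

  open ColouredRibbonGraph G
  open OneEdge e
  open LocalShape
  open Equivalence using (to; from)

  private
    C D : CState n
    C = contractAllBut G e
    D = deleteAllBut G e
    e₀ e₁ s₁ : Flag n
    e₀ = fl e false false
    e₁ = fl e true false
    s₁ = fl e false true

  dualθ-involutive : ∀ x → dualθ θ (dualθ θ x) ≡ x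
  dualθ-involutive x = cong σ (θ-inv (σ x))

  dualθ-fixpoint-free : ∀ x → dualθ θ x ≢ x
  dualθ-fixpoint-free x eq = θ-fpf (σ x) (cong σ eq)

  primal : Σ Shape (LocalShape θ)
  primal = restrictθ-localShape e θ θ-inv θ-fpf

  dual : Σ Shape (LocalShape (dualθ θ))
  dual = restrictθ-localShape e (dualθ θ) dualθ-involutive dualθ-fixpoint-free

  private
    sθ sd : Shape
    sθ = proj₁ primal
    sd = proj₁ dual

  D-alive≗ : ∀ f → CState.alive D f ≡ onlyEdge e f
  D-alive≗ = process-others-alive e deleteEdge (λ _ _ → refl) (toState G) (λ _ → refl)

  C-alive≗ : ∀ f → CState.alive C f ≡ onlyEdge e f
  C-alive≗ = process-others-alive e contractEdge (λ _ _ → refl) (toState G) (λ _ → refl)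

  private
    αC αD : Fin n → Bool
    αC = CState.alive C
    αD = CState.alive D

    e-alive : (α : Fin n → Bool) → (∀ f → α f ≡ onlyEdge e f) → α e ≡ true
    e-alive α α≗ = trans (α≗ e) (onlyEdge-self e)

  D-removed : RemovedFrom θ D
  D-removed = deleteEdges-removedFrom θ-inv (others e) (toState G) (toState-removedFrom G)

  C-removed : RemovedFrom (partialDual αC θ) C
  C-removed = contractEdges-removedFrom θ-inv (others e) (toState G) (others-unique e)
                                        (All.tabulate λ _ → refl) (toState-removedFrom G)

  D-shape : HasShape (CState.θ D) sθ
  D-shape = hasShape⁺ λ p →
    trans (D-removed (e , p) (e-alive αD D-alive≗))
          (trans (restrictθ-cong D-alive≗ (λ _ → refl) (e , p)) (shape≡ (local (proj₂ primal)) p))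

  σDead-C : ∀ x → σDead αC x ≡ σ (σAt e x)
  σDead-C x rewrite C-alive≗ (edgeOf x) with e ≟ edgeOf x
  ... | yes _ = refl
  ... | no _  = refl

  σ-σAt : ∀ x → σ (σAt e x) ≡ σAt e (σ x)
  σ-σAt x with e ≟ edgeOf x
  ... | yes _ = refl
  ... | no _  = refl

  -- The partial dual of 𝔾 at e^c is the partial dual of 𝔾* at e.
  partialDual-C : ∀ x → partialDual αC θ x ≡ σAt e (dualθ θ (σAt e x))
  partialDual-C x = trans (σDead-C _) (trans (σ-σAt _) (cong (σAt e ∘ σ ∘ θ) (σDead-C x)))

  C-shape : HasShape (CState.θ C) (dualShape sd)
  C-shape = hasShape⁺ λ p → begin
    CState.θ C (e , p)
      ≡⟨ C-removed (e , p) (e-alive αC C-alive≗) ⟩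
    restrictθ αC (partialDual αC θ) (e , p)
      ≡⟨ restrictθ-cong C-alive≗ partialDual-C (e , p) ⟩
    restrictθ (onlyEdge e) (λ x → σAt e (dualθ θ (σAt e x))) (e , p)
      ≡⟨ σAt-restrictθ (onlyEdge e) e (onlyEdge-self e) (dualθ θ) (e , p) ⟨
    σAt e (subθ (dualθ θ) e (σAt e (e , p)))
      ≡⟨ cong (σAt e ∘ subθ (dualθ θ) e) (σAt-same e (e , p) refl) ⟩
    σAt e (subθ (dualθ θ) e (σ (e , p)))
      ≡⟨ σAt-same e _ (cong proj₁ (sym (shape≡ (local (proj₂ dual)) _))) ⟩
    σ (subθ (dualθ θ) e (σ (e , p)))
      ≡⟨ shape≡ (hasShape-σ (local (proj₂ dual))) p ⟩
    (e , shapeFlip (dualShape sd) p) ∎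
    where open ≡-Reasoning

  private
    LD : LocalShape (CState.θ D) sθ
    LD = hasShape⇒localShape e D-shape
    LC : LocalShape (CState.θ C) (dualShape sd)
    LC = hasShape⇒localShape e C-shape

  colV-end : ∀ f i s → Σ Bool λ b → colV (fl f i s) ≡ colV (fl f b false)
  colV-end f i false = i , refl
  colV-end f i true  = i , colV-vertex _ _ (inj₂ refl ◅ ε)

  colB-end : ∀ f i s → Σ Bool λ b → colB (fl f i s) ≡ colB (fl f false b)
  colB-end f false s = s , refl
  colB-end f true  s = s , colB-face _ _ (inj₂ refl ◅ ε)

  module V = WithoutEdge e colV (λ f b → fl f b false) (λ _ _ → refl) colV-end
  module B = WithoutEdge e colB (λ f b → fl f false b) (λ _ _ → refl) colB-end

  private
    QV QB : Rel (Flag n) 0ℓ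
    QV = mergeEdges (others e) V.SameColour
    QB = mergeEdges (others e) B.SameColour

    QV-isEquivalence : IsEquivalence QV
    QV-isEquivalence = mergeEdges-isEquivalence (others e) V.sameColour-isEquivalence

    QB-isEquivalence : IsEquivalence QB
    QB-isEquivalence = mergeEdges-isEquivalence (others e) B.sameColour-isEquivalence

    dead-other : ∀ {α} → (∀ f → α f ≡ onlyEdge e f) → ∀ y → Dead α y → edgeOf y ∈ others e
    dead-other α≗ y dead =
      ∈-others e λ { refl → false≢true (trans (sym dead) (trans (α≗ e) (onlyEdge-self e))) }

  C-VRel⇔connected : CState.VRel C e₀ e₁ ⇔ Star V.Adj (colV e₀) (colV e₁)
  C-VRel⇔connected =
    V.merged⇔connected ⇔-∘ ≡⇒⇔ (cong (λ R → R e₀ e₁) (contractEdges-VRel (others e) (toState G)))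

  D-BRel⇔connected : CState.BRel D e₀ s₁ ⇔ Star B.Adj (colB e₀) (colB s₁)
  D-BRel⇔connected =
    B.merged⇔connected ⇔-∘ ≡⇒⇔ (cong (λ R → R e₀ s₁) (deleteEdges-BRel (others e) (toState G)))

  C-BRel⇔loop : CState.BRel C e₀ s₁ ⇔ LoopInGdB G e
  C-BRel⇔loop = ≡⇒⇔ (cong (λ R → R e₀ s₁) (contractEdges-BRel (others e) (toState G)))

  D-VRel⇔loop : CState.VRel D e₀ e₁ ⇔ LoopInGV G e
  D-VRel⇔loop = ≡⇒⇔ (cong (λ R → R e₀ e₁) (deleteEdges-VRel (others e) (toState G)))

  C-VRel⇔¬bridge : CState.VRel C e₀ e₁ ⇔ (¬ BridgeInGV G e)
  C-VRel⇔¬bridge = mk⇔ (λ v bridge → bridge (to C-VRel⇔connected v))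
                       (from C-VRel⇔connected ∘ V.connected-stable)

  D-BRel⇔¬bridge : CState.BRel D e₀ s₁ ⇔ (¬ BridgeInGdB G e)
  D-BRel⇔¬bridge = mk⇔ (λ b bridge → bridge (to D-BRel⇔connected b))
                       (from D-BRel⇔connected ∘ B.connected-stable)

  doop⇒loopInGdB : IsDoop θ e → LoopInGdB G e
  doop⇒loopInGdB doop = colB-face e₀ s₁ (sameVertex-dual⇒sameFace doop)

  loop⇒loopInGV : IsLoop θ e → LoopInGV G e
  loop⇒loopInGV = colV-vertex e₀ e₁

  open IsEquivalence QV-isEquivalence using () renaming (refl to QV-refl; trans to QV-trans)
  open IsEquivalence QB-isEquivalence using () renaming (trans to QB-trans)

  C-VRel-step : ∀ x → Alive αC x → QV x (CState.θ C x)
  C-VRel-step x a = subst (QV x) (sym (C-removed x a))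
    (restrictθ-within QV-isEquivalence αC (partialDual αC θ) partialDual-within θ₂-within x)
    where
      θ₂-within : ∀ y → Dead αC y → QV y (θ₂ y)
      θ₂-within y _ = mergeEdges-⊇ (others e) (colV-vertex y (θ₂ y) (inj₂ refl ◅ ε))
      σDead-within : ∀ y → QV y (σDead αC y)
      σDead-within y with αC (edgeOf y) in y-alive
      ... | true  = QV-refl
      ... | false = mergeEdges-sameEdge (others e) (dead-other C-alive≗ y y-alive) (refl , refl)
      partialDual-within : ∀ y → QV y (partialDual αC θ y)
      partialDual-within y = QV-trans (σDead-within y)
        (QV-trans (mergeEdges-⊇ (others e) (colV-vertex _ _ (inj₁ refl ◅ ε))) (σDead-within _))

  D-BRel-step : ∀ x → Alive αD x → QB x (CState.θ D x)
  D-BRel-step x a = subst (QB x) (sym (D-removed x a))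
    (restrictθ-within QB-isEquivalence αD θ
      (λ y → mergeEdges-⊇ (others e) (colB-face y (θ y) (inj₁ refl ◅ ε)))
      (λ y dead → mergeEdges-sameEdge (others e) (dead-other D-alive≗ y dead) (refl , refl)) x)

  C-loop⇒VRel : IsLoop (CState.θ C) e → CState.VRel C e₀ e₁
  C-loop⇒VRel loop = subst (λ R → R e₀ e₁) (sym (contractEdges-VRel (others e) (toState G)))
                           (by-shape (dualShape sd) C-shape)
    where
      by-shape : ∀ sh → HasShape (CState.θ C) sh → QV e₀ e₁
      by-shape separate  hs = ⊥-elim (separate-not-loop hs loop)
      by-shape untwisted hs = subst (QV e₀) (shape≡ hs (false , false)) (C-VRel-step e₀ (e-alive αC C-alive≗))
      by-shape twisted   hs = QV-trans (mergeEdges-⊇ (others e) (colV-vertex e₀ s₁ (inj₂ refl ◅ ε)))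
        (subst (QV s₁) (shape≡ hs (false , true)) (C-VRel-step s₁ (e-alive αC C-alive≗)))

  D-BRel : ¬ OrientableLoop (CState.θ D) e → CState.BRel D e₀ s₁
  D-BRel ¬orientable = subst (λ R → R e₀ s₁) (sym (deleteEdges-BRel (others e) (toState G)))
                             (by-shape sθ D-shape (¬orientable ∘ from (orientableLoop⇔untwisted LD)))
    where
      θ₀-step : ∀ y → QB y (θ₀ y)
      θ₀-step y = mergeEdges-⊇ (others e) (colB-face y (θ₀ y) (inj₂ refl ◅ ε))
      by-shape : ∀ sh → HasShape (CState.θ D) sh → sh ≢ untwisted → QB e₀ s₁
      by-shape separate  hs _   = QB-trans (θ₀-step e₀) (QB-trans
        (subst (QB e₁) (shape≡ hs (true , false)) (D-BRel-step e₁ (e-alive αD D-alive≗))) (θ₀-step _))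
      by-shape untwisted _  sh≢ = ⊥-elim (sh≢ refl)
      by-shape twisted   hs _   = QB-trans (θ₀-step e₀)
        (subst (QB e₁) (shape≡ hs (true , false)) (D-BRel-step e₁ (e-alive αD D-alive≗)))

  C-¬loop⇔orientableDoop : (¬ IsLoop (CState.θ C) e) ⇔ OrientableDoop θ e
  C-¬loop⇔orientableDoop =
    (⇔-sym (orientableLoop⇔untwisted (proj₂ dual)) ⇔-∘ dualShape-⇔) ⇔-∘ not-loop⇔separate LC

  C-orientableLoop⇔¬doop : OrientableLoop (CState.θ C) e ⇔ (¬ IsDoop θ e)
  C-orientableLoop⇔¬doop =
    (⇔-sym (not-loop⇔separate (proj₂ dual)) ⇔-∘ dualShape-⇔) ⇔-∘ orientableLoop⇔untwisted LC

  C-nonOrientableLoop⇔nonOrientableDoop : NonOrientableLoop (CState.θ C) e ⇔ NonOrientableDoop θ e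
  C-nonOrientableLoop⇔nonOrientableDoop =
    (⇔-sym (nonOrientableLoop⇔twisted (proj₂ dual)) ⇔-∘ dualShape-⇔) ⇔-∘ nonOrientableLoop⇔twisted LC

  D-¬loop⇔¬loop : (¬ IsLoop (CState.θ D) e) ⇔ (¬ IsLoop θ e)
  D-¬loop⇔¬loop = ⇔-sym (not-loop⇔separate (proj₂ primal)) ⇔-∘ not-loop⇔separate LD

  D-orientableLoop⇔orientableLoop : OrientableLoop (CState.θ D) e ⇔ OrientableLoop θ e
  D-orientableLoop⇔orientableLoop =
    ⇔-sym (orientableLoop⇔untwisted (proj₂ primal)) ⇔-∘ orientableLoop⇔untwisted LD

  D-nonOrientableLoop⇔nonOrientableLoop : NonOrientableLoop (CState.θ D) e ⇔ NonOrientableLoop θ e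
  D-nonOrientableLoop⇔nonOrientableLoop =
    ⇔-sym (nonOrientableLoop⇔twisted (proj₂ primal)) ⇔-∘ nonOrientableLoop⇔twisted LD

  C-loop⇒¬bridge : IsLoop (CState.θ C) e → ¬ BridgeInGV G e
  C-loop⇒¬bridge = to C-VRel⇔¬bridge ∘ C-loop⇒VRel

  D-¬bridge : ¬ OrientableLoop (CState.θ D) e → ¬ BridgeInGdB G e
  D-¬bridge = to D-BRel⇔¬bridge ∘ D-BRel

  contraction : (IsBS C e ⇔ (LoopInGdB G e × OrientableDoop θ e × BridgeInGV G e))
              × (IsBP C e ⇔ (LoopInGdB G e × OrientableDoop θ e × ¬ BridgeInGV G e))
              × (IsOLC C e ⇔ (¬ LoopInGdB G e × ¬ IsDoop θ e × ¬ BridgeInGV G e))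
              × (IsOLH C e ⇔ (LoopInGdB G e × ¬ IsDoop θ e × ¬ BridgeInGV G e))
              × (IsNL C e ⇔ (LoopInGdB G e × NonOrientableDoop θ e × ¬ BridgeInGV G e))
  contraction =
    with-side-first C-¬loop⇔orientableDoop (¬-cong-⇔ C-VRel⇔connected) ¬loop⇒loopInGdB ,
    with-side-first C-¬loop⇔orientableDoop C-VRel⇔¬bridge ¬loop⇒loopInGdB ,
    with-side-last C-orientableLoop⇔¬doop (¬-cong-⇔ C-BRel⇔loop) (C-loop⇒¬bridge ∘ proj₁) ,
    with-side-last C-orientableLoop⇔¬doop C-BRel⇔loop (C-loop⇒¬bridge ∘ proj₁) ,
    with-sides C-nonOrientableLoop⇔nonOrientableDoop
      (doop⇒loopInGdB ∘ proj₁ ∘ to C-nonOrientableLoop⇔nonOrientableDoop) (C-loop⇒¬bridge ∘ proj₁)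
    where
      ¬loop⇒loopInGdB : ¬ IsLoop (CState.θ C) e → LoopInGdB G e
      ¬loop⇒loopInGdB = doop⇒loopInGdB ∘ proj₁ ∘ to C-¬loop⇔orientableDoop

  deletion : (IsBS D e ⇔ (¬ BridgeInGdB G e × ¬ IsLoop θ e × ¬ LoopInGV G e))
           × (IsBP D e ⇔ (¬ BridgeInGdB G e × ¬ IsLoop θ e × LoopInGV G e))
           × (IsOLC D e ⇔ (BridgeInGdB G e × OrientableLoop θ e × LoopInGV G e))
           × (IsOLH D e ⇔ (¬ BridgeInGdB G e × OrientableLoop θ e × LoopInGV G e))
           × (IsNL D e ⇔ (¬ BridgeInGdB G e × NonOrientableLoop θ e × LoopInGV G e))
  deletion =
    with-side-first D-¬loop⇔¬loop (¬-cong-⇔ D-VRel⇔loop) ¬loop⇒¬bridge ,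
    with-side-first D-¬loop⇔¬loop D-VRel⇔loop ¬loop⇒¬bridge ,
    with-side-last D-orientableLoop⇔orientableLoop (¬-cong-⇔ D-BRel⇔connected) orientable⇒loopInGV ,
    with-side-last D-orientableLoop⇔orientableLoop D-BRel⇔¬bridge orientable⇒loopInGV ,
    with-sides D-nonOrientableLoop⇔nonOrientableLoop
      (λ (_ , ¬orientable) → D-¬bridge (¬orientable ∘ proj₂))
      (loop⇒loopInGV ∘ proj₁ ∘ to D-nonOrientableLoop⇔nonOrientableLoop)
    where
      ¬loop⇒¬bridge : ¬ IsLoop (CState.θ D) e → ¬ BridgeInGdB G e
      ¬loop⇒¬bridge ¬loop = D-¬bridge (¬loop ∘ proj₁)
      orientable⇒loopInGV : OrientableLoop (CState.θ D) e → LoopInGV G e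
      orientable⇒loopInGV = loop⇒loopInGV ∘ proj₁ ∘ to D-orientableLoop⇔orientableLoop

lemma6p2 : ∀ {n} (G : ColouredRibbonGraph n) (e : Fin n) →
    let θ = ColouredRibbonGraph.θ G
        C = contractAllBut G e
        D = deleteAllBut G e
    in (IsBS C e ⇔ (LoopInGdB G e × OrientableDoop θ e × BridgeInGV G e))
     × (IsBP C e ⇔ (LoopInGdB G e × OrientableDoop θ e × ¬ BridgeInGV G e))
     × (IsOLC C e ⇔ (¬ LoopInGdB G e × ¬ IsDoop θ e × ¬ BridgeInGV G e))
     × (IsOLH C e ⇔ (LoopInGdB G e × ¬ IsDoop θ e × ¬ BridgeInGV G e))
     × (IsNL C e ⇔ (LoopInGdB G e × NonOrientableDoop θ e × ¬ BridgeInGV G e))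
     × (IsBS D e ⇔ (¬ BridgeInGdB G e × ¬ IsLoop θ e × ¬ LoopInGV G e))
     × (IsBP D e ⇔ (¬ BridgeInGdB G e × ¬ IsLoop θ e × LoopInGV G e))
     × (IsOLC D e ⇔ (BridgeInGdB G e × OrientableLoop θ e × LoopInGV G e))
     × (IsOLH D e ⇔ (¬ BridgeInGdB G e × OrientableLoop θ e × LoopInGV G e))
     × (IsNL D e ⇔ (¬ BridgeInGdB G e × NonOrientableLoop θ e × LoopInGV G e))
lemma6p2 G e =
  let c₁ , c₂ , c₃ , c₄ , c₅ = Characterisation.contraction G e
      d₁ , d₂ , d₃ , d₄ , d₅ = Characterisation.deletion G e
  in c₁ , c₂ , c₃ , c₄ , c₅ , d₁ , d₂ , d₃ , d₄ , d₅
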